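{- Let $V_\bullet=\bigoplus_n V_n$, where $V_n\subseteq\mathcal M_n$ is the span of the classes $[\mathsf M,\eta]$ with $\mathsf M$ connected, and let $V_{\mathrm{even}}=\bigoplus_k V_{2k}$, $V_{\mathrm{odd}}=\bigoplus_k V_{2k+1}$. The unique graded algebra morphism $\Psi:\mathrm{Sym}(V_{\mathrm{even}})\otimes\bigwedge V_{\mathrm{odd}}\to(\mathcal M_\bullet,\star)$ extending the inclusion $V_\bullet\hookrightarrow\mathcal M_\bullet$ is an isomorphism of graded algebras. Thus $(\mathcal M_\bullet,\star)$ is the free super-commutative algebra on its connected classes.
   Context: Matroids have finite ground set $E(\mathsf M)$. A matroid is connected if it is nonempty and cannot be written as a direct sum of two nonempty matroids (the empty matroid is not connected). An orientation of $\mathsf M$ is a generator $\eta$ of $\bigwedge^{|E|}\mathbb{Z}\langle E\rangle$, $E=E(\mathsf M)$; $\varnothing$ has orientation $1$. $\mathcal M$ is the $\mathbb{Q}$-vector space spanned by symbols $[\mathsf M,\eta]$ modulo $[\mathsf M,-\eta]=-[\mathsf M,\eta]$ and $[\mathsf M,\eta]=[\mathsf M',\psi_*\eta]$ for every isomorphism $\psi:\mathsf M\to\mathsf M'$ ($\psi_*$ the induced map on top exterior powers), graded by ground-set size ($\mathcal M_\bullet$, $\mathcal M_n$ the span of classes with $|E(\mathsf M)|=n$). The product is $[\mathsf M,\eta]\star[\mathsf Q,\omega]=[\mathsf M\oplus\mathsf Q,\eta\wedge\omega]$ (ground sets disjoint); it is associative, unital with unit $[\varnothing,1]$, and graded-commutative: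 $a\star b=(-1)^{|a||b|}b\star a$ for homogeneous $a,b$. $\mathrm{Sym}(V_{\mathrm{even}})\otimes\bigwedge V_{\mathrm{odd}}$ is the free graded-commutative algebra on the graded vector space $V_\bullet$. -}

module Defs where

open import Level using (0ℓ) renaming (suc to lsuc)
open import Data.Bool using (Bool; true; false; _∧_; if_then_else_)
open import Data.Nat using (ℕ; zero; suc; _+_; _*_; _<_; _≤_)
open import Data.Nat.Properties using (+-assoc; +-comm; +-identityʳ)
open import Data.Fin using (Fin)
import Data.Fin.Properties as FinP
open import Data.Fin.Subset using (Subset; ⊥; _⊆_; _∈_; _∉_; ∣_∣; _∪_; _∩_; ∁; ⁅_⁆; Nonempty)
open import Data.Fin.Permutation using (Permutation′; _⟨$⟩ʳ_; _⟨$⟩ˡ_)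
open import Data.Vec using (Vec; lookup; tabulate; take; drop)
open import Data.List using (List; map; allFin)
open import Data.Nat.ListAction using (sum)
open import Data.Product using (Σ; ∃; _×_; _,_)
import Data.Product
open import Data.Rational using (ℚ; 1ℚ; -_) renaming (_+_ to _+ℚ_; _*_ to _*ℚ_)
open import Data.Rational.Properties using (+-*-commutativeRing)
import Data.Sign as Sg
open import Algebra.Module.Bundles using (Module)
open import Relation.Nullary using (¬_)
open import Relation.Nullary.Decidable using (⌊_⌋)
open import Relation.Binary.PropositionalEquality using (_≡_; sym; subst)

record Matroid (n : ℕ) : Set where
  field
    indep     : Subset n → Bool
    indep-∅   : indep ⊥ ≡ true
    indep-↓   : ∀ A B → A ⊆ B → indep B ≡ true → indep A ≡ true
    indep-aug : ∀ A B → indep A ≡ true → indep B ≡ true → ∣ A ∣ < ∣ B ∣ →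
                ∃ λ x → x ∈ B × x ∉ A × indep (⁅ x ⁆ ∪ A) ≡ true
open Matroid public

image : ∀ {n} → Permutation′ n → Subset n → Subset n
image ψ S = tabulate (λ j → lookup S (ψ ⟨$⟩ˡ j))

IsIso : ∀ {n} → Permutation′ n → Matroid n → Matroid n → Set
IsIso ψ M M' = ∀ S → indep M' (image ψ S) ≡ indep M S

inversions : ∀ {n} → Permutation′ n → ℕ
inversions {n} ψ = sum (map (λ i → sum (map (λ j →
  if ⌊ i FinP.<? j ⌋ ∧ ⌊ (ψ ⟨$⟩ʳ j) FinP.<? (ψ ⟨$⟩ʳ i) ⌋ then 1 else 0)
  (allFin n))) (allFin n))

paritySign : ℕ → Sg.Sign
paritySign zero = Sg.+
paritySign (suc k) = Sg.opposite (paritySign k)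

-- sgn ψ ; ψ_* (e_0 ∧ … ∧ e_{n-1}) = sgn ψ · (e_0 ∧ … ∧ e_{n-1})
sgn : ∀ {n} → Permutation′ n → Sg.Sign
sgn ψ = paritySign (inversions ψ)

IsDirectSum : ∀ {n m} → Matroid n → Matroid m → Matroid (n + m) → Set
IsDirectSum {n} M Q R = ∀ S → indep R S ≡ (indep M (take n S) ∧ indep Q (drop n S))

Connected : ∀ {n} → Matroid n → Set
Connected {n} M = (1 ≤ n) × ¬ (Σ (Subset n) λ S → Nonempty S × Nonempty (∁ S) ×
   (∀ I → indep M I ≡ (indep M (I ∩ S) ∧ indep M (I ∩ ∁ S))))

-- The ℚ-vector space M_n, presented by generators [M , s] (s a sign:
-- orientation s · e_0 ∧ … ∧ e_{n-1}) and relations.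

infixl 6 _⊞_
infixr 7 _⊡_
data Term (n : ℕ) : Set where
  [_,_] : Matroid n → Sg.Sign → Term n
  𝟘     : Term n
  _⊞_   : Term n → Term n → Term n
  _⊡_   : ℚ → Term n → Term n

infix 4 _∼_
data _∼_ {n : ℕ} : Term n → Term n → Set where
  ∼-refl  : ∀ {x} → x ∼ x
  ∼-sym   : ∀ {x y} → x ∼ y → y ∼ x
  ∼-trans : ∀ {x y z} → x ∼ y → y ∼ z → x ∼ z
  ⊞-cong  : ∀ {x x' y y'} → x ∼ x' → y ∼ y' → x ⊞ y ∼ x' ⊞ y'
  ⊡-cong  : ∀ {q x x'} → x ∼ x' → q ⊡ x ∼ q ⊡ x'
  ⊞-assoc : ∀ x y z → (x ⊞ y) ⊞ z ∼ x ⊞ (y ⊞ z)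
  ⊞-comm  : ∀ x y → x ⊞ y ∼ y ⊞ x
  ⊞-idˡ   : ∀ x → 𝟘 ⊞ x ∼ x
  ⊞-inv   : ∀ x → x ⊞ ((- 1ℚ) ⊡ x) ∼ 𝟘
  ⊡-distˡ : ∀ q x y → q ⊡ (x ⊞ y) ∼ q ⊡ x ⊞ q ⊡ y
  ⊡-distʳ : ∀ p q x → (p +ℚ q) ⊡ x ∼ p ⊡ x ⊞ q ⊡ x
  ⊡-assoc : ∀ p q x → (p *ℚ q) ⊡ x ∼ p ⊡ (q ⊡ x)
  ⊡-id    : ∀ x → 1ℚ ⊡ x ∼ x
  orient  : ∀ M s → [ M , Sg.opposite s ] ∼ (- 1ℚ) ⊡ [ M , s ]
  iso     : ∀ M M' (ψ : Permutation′ n) → IsIso ψ M M' →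
            ∀ s → [ M , s ] ∼ [ M' , sgn ψ Sg.* s ]

data InV {n : ℕ} : Term n → Set where
  gen : ∀ M s → Connected M → InV [ M , s ]
  𝟘   : InV 𝟘
  _⊞_ : ∀ {x y} → InV x → InV y → InV (x ⊞ y)
  _⊡_ : ∀ q {x} → InV x → InV (q ⊡ x)

V : ℕ → Set
V n = Σ (Term n) InV

ℚring = +-*-commutativeRing

sgnℚ : ℕ → ℚ
sgnℚ zero = 1ℚ
sgnℚ (suc k) = - sgnℚ k

record GradedCommAlg : Set₁ where
  field
    Mod : ℕ → Module ℚring 0ℓ 0ℓ
  Car : ℕ → Set
  Car n = Module.Carrierᴹ (Mod n)
  _≈_ : ∀ {n} → Car n → Car n → Set
  _≈_ {n} = Module._≈ᴹ_ (Mod n)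
  _+ᴬ_ : ∀ {n} → Car n → Car n → Car n
  _+ᴬ_ {n} = Module._+ᴹ_ (Mod n)
  _*ᴬ_ : ∀ {n} → ℚ → Car n → Car n
  _*ᴬ_ {n} = Module._*ₗ_ (Mod n)
  0ᴬ : ∀ {n} → Car n
  0ᴬ {n} = Module.0ᴹ (Mod n)
  field
    _·_    : ∀ {n m} → Car n → Car m → Car (n + m)
    one    : Car 0
    ·-cong : ∀ {n m} {x x' : Car n} {y y' : Car m} → x ≈ x' → y ≈ y' → (x · y) ≈ (x' · y')
    ·-distˡ : ∀ {n m} (x : Car n) (y z : Car m) → (x · (y +ᴬ z)) ≈ ((x · y) +ᴬ (x · z))
    ·-distʳ : ∀ {n m} (x y : Car n) (z : Car m) → ((x +ᴬ y) · z) ≈ ((x · z) +ᴬ (y · z))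
    ·-scalˡ : ∀ {n m} q (x : Car n) (y : Car m) → ((q *ᴬ x) · y) ≈ (q *ᴬ (x · y))
    ·-scalʳ : ∀ {n m} q (x : Car n) (y : Car m) → (x · (q *ᴬ y)) ≈ (q *ᴬ (x · y))
    ·-idˡ  : ∀ {n} (x : Car n) → (one · x) ≈ x
    ·-idʳ  : ∀ {n} (x : Car n) → (x · one) ≈ subst Car (sym (+-identityʳ n)) x
    ·-assoc : ∀ {n m k} (x : Car n) (y : Car m) (z : Car k) →
              ((x · y) · z) ≈ subst Car (sym (+-assoc n m k)) (x · (y · z))
    ·-gcomm : ∀ {n m} (x : Car n) (y : Car m) →
              (x · y) ≈ (sgnℚ (n * m) *ᴬ subst Car (+-comm m n) (y · x))

module _ (A : GradedCommAlg) where
  open GradedCommAlg A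

  record LinearV : Set where
    field
      fun  : ∀ {n} → V n → Car n
      cong : ∀ {n} (v w : V n) → Data.Product.proj₁ v ∼ Data.Product.proj₁ w → fun v ≈ fun w
      additive : ∀ {n} (v w : V n) →
        fun (Data.Product.proj₁ v ⊞ Data.Product.proj₁ w , Data.Product.proj₂ v ⊞ Data.Product.proj₂ w)
          ≈ (fun v +ᴬ fun w)
      homog : ∀ {n} q (v : V n) →
        fun (q ⊡ Data.Product.proj₁ v , q ⊡ Data.Product.proj₂ v) ≈ (q *ᴬ fun v)
  open LinearV public

  record IsExtMorphism (f : LinearV) (F : ∀ {n} → Term n → Car n) : Set where
    field
      resp     : ∀ {n} {x y : Term n} → x ∼ y → F x ≈ F y
      F-zero   : ∀ {n} → F {n} 𝟘 ≈ 0ᴬ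
      F-add    : ∀ {n} (x y : Term n) → F (x ⊞ y) ≈ (F x +ᴬ F y)
      F-scal   : ∀ {n} q (x : Term n) → F (q ⊡ x) ≈ (q *ᴬ F x)
      F-unit   : ∀ (E : Matroid 0) → F [ E , Sg.+ ] ≈ one
      -- [M , η] ⋆ [Q , ω] = [M ⊕ Q , η ∧ ω] ↦ F [M , η] · F [Q , ω]
      F-mult   : ∀ {n m} (M : Matroid n) (Q : Matroid m) (R : Matroid (n + m)) →
                 IsDirectSum M Q R → ∀ s t →
                 F [ R , s Sg.* t ] ≈ (F [ M , s ] · F [ Q , t ])
      F-extends : ∀ {n} (v : V n) → F (Data.Product.proj₁ v) ≈ fun f v

-- A matroid is the direct sum of its connected components, so in 𝓜 its class is, up to the sign
-- of a shuffle, the ⋆-product of the classes of its components.  A morphism extending f must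
-- therefore send [ M , + ] to
--   Φ M = crossingSign C · f [ M ↾ C , + ] · Φ (M ↾ ∁ C),
-- where C is the component of the least element and crossingSign C is the sign of the shuffle moving
-- C to the front; induction on the size gives uniqueness.  For existence, define Φ by this recursion
-- and show that it splits in the same way along every separator S: for 0 ∈ S by splitting M ↾ ∁ C
-- and M ↾ S once more (the two composite shuffles have the same sign), and for 0 ∉ S by graded
-- commutativity, which costs exactly the sign of swapping S and ∁ S.  Splitting M' along ψ(C) for an
-- isomorphism ψ : M → M' gives invariance under isomorphisms, because sgn ψ factors through the
-- signs of ψ restricted to C and to ∁ C; splitting a direct sum along its first summand gives
-- multiplicativity.

module Submission where

import Algebra.Lattice.Properties.BooleanAlgebra as BooleanAlgebraₚ
open import Algebra.Module.Bundles using (Module)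
import Algebra.Properties.CommutativeMonoid.Sum as CommutativeMonoidSum
import Algebra.Properties.CommutativeSemigroup as CommutativeSemigroupProperties
open import Data.Bool using (Bool; true; false; _∧_; _∨_; not; if_then_else_)
open import Data.Bool.Properties using (∧-assoc; ∧-comm; ∧-identityʳ; ∧-zeroʳ; ¬-not)
import Data.Bool.Properties as Boolₚ
open import Data.Fin using (Fin; zero; suc; _↑ˡ_; _↑ʳ_; splitAt)
open import Data.Fin.Properties using (nonZeroIndex)
import Data.Fin.Properties as Finₚ
open import Data.Fin.Permutation using (Permutation; _⟨$⟩ʳ_; _⟨$⟩ˡ_; flip; inverseˡ; inverseʳ; permutation)
import Data.Fin.Permutation as Perm
open import Data.Fin.Subset using (Subset; ∣_∣; _∈_; _∉_; _⊆_; _∩_; _∪_; ∁; ⊥; ⊤; ⁅_⁆; Nonempty)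
open import Data.Fin.Subset.Properties
  using ( _∈?_; anySubset?; ∈⊤; ⊆⊤; ⊆-antisym; drop-∷-⊆; x∈⁅x⁆; x∈⁅y⁆⇒x≡y
        ; x∈p⇒x∉∁p; x∈∁p⇒x∉p; x∉p⇒x∈∁p; p⊆q⇒∁p⊇∁q; p∩q⊆p; p∩q⊆q; x∈p∩q⁺
        ; ∩-assoc; ∩-comm; ∩-identityʳ; ∩-zeroʳ; ∪-identityˡ; ∣⊤∣≡n; ∣⊥∣≡0; ∪-∩-booleanAlgebra )
import Data.List as List
import Data.List.Properties as Listₚ
open import Data.Nat using (ℕ; zero; suc; _+_; _*_; _<_; _≤_; pred; s≤s; s≤s⁻¹; >-nonZero⁻¹)
import Data.Nat.Properties as ℕₚ
open import Data.Nat.ListAction using (sum)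
open import Data.Nat.Induction using (<-rec)
open import Data.Product using (Σ; ∃; _×_; _,_; proj₁; proj₂)
open import Data.Rational using (ℚ; 1ℚ; 0ℚ; -_) renaming (_*_ to _*ℚ_)
open import Data.Sign using (Sign; opposite) renaming (_*_ to _*ˢ_)
import Data.Sign as Sign
import Data.Sign.Properties as Signₚ
open import Data.Sum using (inj₁; inj₂; [_,_]′)
open import Data.Vec using (Vec; []; _∷_; here; there; lookup; tabulate; take; drop; cast; _++_)
open import Data.Vec.Properties
  using ([]=⇒lookup; lookup⇒[]=; lookup∘tabulate; lookup-zipWith; lookup-map; lookup-replicate; cast-is-id; cast-trans)
open import Data.Vec.Relation.Binary.Pointwise.Extensional using (ext; Pointwise-≡⇒≡)
open import Function using (_∘_)
open import Relation.Binary using (tri<; tri≈; tri>)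
open import Relation.Binary.PropositionalEquality
  using (_≡_; _≢_; refl; sym; trans; cong; cong₂; subst; subst₂; module ≡-Reasoning)
import Relation.Binary.Reasoning.Setoid as SetoidReasoning
open import Relation.Nullary using (Dec; yes; no; ¬_; ¬?; _×-dec_; contradiction)
open import Relation.Nullary.Decidable using (⌊_⌋; does; isYes≗does; dec-true; dec-false; decidable-stable)
open import Relation.Unary using (Decidable)
open import Defs renaming (cong to fun-cong)

open CommutativeSemigroupProperties Signₚ.*-commutativeSemigroup using (interchange; x∙yz≈y∙xz)

open CommutativeMonoidSum Signₚ.*-commutativeMonoid
  using ()
  renaming (sum to ∏; sum-cong-≗ to ∏-cong; ∑-distrib-+ to ∏-distrib; ∑-comm to ∏-comm;
            sum-permute to ∏-permute; sum-replicate-zero to ∏-+)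

open CommutativeMonoidSum ℕₚ.+-0-commutativeMonoid using ()
  renaming (sum to ∑; sum-cong-≗ to ∑-cong; sum-permute to ∑-permute)

-- Signs of permutations

-- Defs uses ⌊ i <? j ⌋; with `does` instead, suc i <ᵇ suc j reduces to i <ᵇ j.
infix 7 _<ᵇ_
_<ᵇ_ : ∀ {n} → Fin n → Fin n → Bool
i <ᵇ j = does (i Finₚ.<? j)

toSign : Bool → Sign
toSign true  = Sign.-
toSign false = Sign.+

paritySign-+ : ∀ a b → paritySign (a + b) ≡ paritySign a *ˢ paritySign b
paritySign-+ zero    b = refl
paritySign-+ (suc a) b = trans (cong opposite (paritySign-+ a b)) (opposite-*ˢ (paritySign a) _)
  where
  opposite-*ˢ : ∀ s t → opposite (s *ˢ t) ≡ opposite s *ˢ t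
  opposite-*ˢ Sign.- t = Signₚ.opposite-involutive t
  opposite-*ˢ Sign.+ t = refl

paritySign-sum : ∀ n (g : Fin n → ℕ) → paritySign (sum (List.map g (List.allFin n))) ≡ ∏ (paritySign ∘ g)
paritySign-sum n g = trans (cong (paritySign ∘ sum) (Listₚ.map-tabulate (λ i → i) g)) (go n g)
  where
  go : ∀ n (g : Fin n → ℕ) → paritySign (sum (List.tabulate g)) ≡ ∏ (paritySign ∘ g)
  go zero    g = refl
  go (suc n) g = trans (paritySign-+ (g zero) _) (cong (paritySign (g zero) *ˢ_) (go n (g ∘ suc)))

paritySign-toSign : ∀ b → paritySign (if b then 1 else 0) ≡ toSign b
paritySign-toSign true  = refl
paritySign-toSign false = refl

inversions′ : ∀ {a b} → Permutation a b → ℕ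
inversions′ {a} ψ = sum (List.map (λ i → sum (List.map (λ j →
  if ⌊ i Finₚ.<? j ⌋ ∧ ⌊ (ψ ⟨$⟩ʳ j) Finₚ.<? (ψ ⟨$⟩ʳ i) ⌋ then 1 else 0)
  (List.allFin a))) (List.allFin a))

sgn′ : ∀ {a b} → Permutation a b → Sign
sgn′ ψ = paritySign (inversions′ ψ)

inverts : ∀ {a b} → Permutation a b → Fin a → Fin a → Bool
inverts ψ i j = i <ᵇ j ∧ (ψ ⟨$⟩ʳ j) <ᵇ (ψ ⟨$⟩ʳ i)

sgn′-∏ : ∀ {a b} (ψ : Permutation a b) → sgn′ ψ ≡ ∏ λ i → ∏ λ j → toSign (inverts ψ i j)
sgn′-∏ {a} ψ = trans (paritySign-sum a row) (∏-cong λ i →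
  trans (paritySign-sum a (entry i)) (∏-cong (paritySign-entry i)))
  where
  entry : Fin a → Fin a → ℕ
  entry i j = if ⌊ i Finₚ.<? j ⌋ ∧ ⌊ (ψ ⟨$⟩ʳ j) Finₚ.<? (ψ ⟨$⟩ʳ i) ⌋ then 1 else 0
  row : Fin a → ℕ
  row i = sum (List.map (entry i) (List.allFin a))
  paritySign-entry : ∀ i j → paritySign (entry i j) ≡ toSign (inverts ψ i j)
  paritySign-entry i j = trans (paritySign-toSign _)
    (cong toSign (cong₂ _∧_ (isYes≗does (i Finₚ.<? j)) (isYes≗does ((ψ ⟨$⟩ʳ j) Finₚ.<? (ψ ⟨$⟩ʳ i)))))

-- The sign of the shuffle of Fin n moving the elements of C to the front (in order), i.e.
-- (-1) ^ #{(i , j) : i < j, i ∉ C, j ∈ C}.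
crossingSign : ∀ {n} → Subset n → Sign
crossingSign []          = Sign.+
crossingSign (true ∷ C)  = crossingSign C
crossingSign (false ∷ C) = paritySign ∣ C ∣ *ˢ crossingSign C

∏-toSign-lookup : ∀ {n} (C : Subset n) → ∏ (toSign ∘ lookup C) ≡ paritySign ∣ C ∣
∏-toSign-lookup []          = refl
∏-toSign-lookup (true ∷ C)  = cong opposite (∏-toSign-lookup C)
∏-toSign-lookup (false ∷ C) = ∏-toSign-lookup C

crossingSign-∏ : ∀ {n} (C : Subset n) →
  crossingSign C ≡ ∏ λ i → ∏ λ j → toSign (i <ᵇ j ∧ not (lookup C i) ∧ lookup C j)
crossingSign-∏ []              = refl
crossingSign-∏ {suc n} (true ∷ C)  =
  trans (crossingSign-∏ C)
    (sym (cong (_*ˢ ∏ λ i → ∏ λ j → toSign (i <ᵇ j ∧ not (lookup C i) ∧ lookup C j)) (∏-+ n)))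
crossingSign-∏ (false ∷ C) = cong₂ _*ˢ_ (sym (∏-toSign-lookup C)) (crossingSign-∏ C)

<ᵇ-asym : ∀ {n} (i j : Fin n) → (i <ᵇ j ∧ j <ᵇ i) ≡ false
<ᵇ-asym zero    zero    = refl
<ᵇ-asym zero    (suc j) = refl
<ᵇ-asym (suc i) zero    = refl
<ᵇ-asym (suc i) (suc j) = <ᵇ-asym i j

sgn′-id : ∀ {n} → sgn′ (Perm.id {n}) ≡ Sign.+
sgn′-id {n} = begin
  sgn′ (Perm.id {n})                                    ≡⟨ sgn′-∏ (Perm.id {n}) ⟩
  ∏ (λ i → ∏ λ j → toSign (inverts (Perm.id {n}) i j))  ≡⟨ ∏-cong row-+ ⟩
  ∏ {n} (λ _ → Sign.+)                                  ≡⟨ ∏-+ n ⟩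
  Sign.+ ∎
  where
  open ≡-Reasoning
  row-+ : ∀ i → ∏ (λ j → toSign (inverts (Perm.id {n}) i j)) ≡ Sign.+
  row-+ i = trans (∏-cong λ j → cong toSign (<ᵇ-asym i j)) (∏-+ n)

lookup-ext : ∀ {A : Set} {n} {u v : Vec A n} → (∀ i → lookup u i ≡ lookup v i) → u ≡ v
lookup-ext u≗v = Pointwise-≡⇒≡ (ext u≗v)

∉⇒lookup≡false : ∀ {n} {S : Subset n} {x} → x ∉ S → lookup S x ≡ false
∉⇒lookup≡false x∉S = ¬-not (x∉S ∘ lookup⇒[]= _ _)

p⊆q⇒p∩q≡p : ∀ {n} {p q : Subset n} → p ⊆ q → p ∩ q ≡ p
p⊆q⇒p∩q≡p {p = []}        {[]}        p⊆q = refl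
p⊆q⇒p∩q≡p {p = true ∷ p}  {true ∷ q}  p⊆q = cong (true ∷_) (p⊆q⇒p∩q≡p (drop-∷-⊆ p⊆q))
p⊆q⇒p∩q≡p {p = false ∷ p} {_ ∷ q}     p⊆q = cong (false ∷_) (p⊆q⇒p∩q≡p (drop-∷-⊆ p⊆q))
p⊆q⇒p∩q≡p {p = true ∷ p}  {false ∷ q} p⊆q with p⊆q here
... | ()

∁-involutive : ∀ {n} (S : Subset n) → ∁ (∁ S) ≡ S
∁-involutive {n} = BooleanAlgebraₚ.¬-involutive (∪-∩-booleanAlgebra n)

∁⊤ : ∀ {n} → ∁ (⊤ {n}) ≡ ⊥
∁⊤ {n} = BooleanAlgebraₚ.¬⊤≈⊥ (∪-∩-booleanAlgebra n)

∁⊥ : ∀ {n} → ∁ (⊥ {n}) ≡ ⊤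
∁⊥ {n} = BooleanAlgebraₚ.¬⊥≈⊤ (∪-∩-booleanAlgebra n)

allSubsets? : ∀ {n} {P : Subset n → Set} → Decidable P → Dec (∀ S → P S)
allSubsets? P? with anySubset? (λ S → ¬? (P? S))
... | yes (S , ¬PS) = no λ ∀P → ¬PS (∀P S)
... | no ¬∃¬P       = yes λ S → decidable-stable (P? S) λ ¬PS → ¬∃¬P (S , ¬PS)

∣∣+∣∁∣ : ∀ {n} (S : Subset n) → ∣ S ∣ + ∣ ∁ S ∣ ≡ n
∣∣+∣∁∣ []          = refl
∣∣+∣∁∣ (true ∷ S)  = cong suc (∣∣+∣∁∣ S)
∣∣+∣∁∣ (false ∷ S) = trans (ℕₚ.+-suc _ _) (cong suc (∣∣+∣∁∣ S))

nth : ∀ {n} (S : Subset n) → Fin ∣ S ∣ → Fin n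
nth (true ∷ S)  zero    = zero
nth (true ∷ S)  (suc r) = suc (nth S r)
nth (false ∷ S) r       = suc (nth S r)

nth∈ : ∀ {n} (S : Subset n) r → nth S r ∈ S
nth∈ (true ∷ S)  zero    = here
nth∈ (true ∷ S)  (suc r) = there (nth∈ S r)
nth∈ (false ∷ S) r       = there (nth∈ S r)

position : ∀ {n} {S : Subset n} {x} → x ∈ S → Fin ∣ S ∣
position {S = true ∷ S}  here      = zero
position {S = true ∷ S}  (there p) = suc (position p)
position {S = false ∷ S} (there p) = position p

position-cong : ∀ {n} {S : Subset n} {x y} → x ≡ y → (p : x ∈ S) (q : y ∈ S) → position p ≡ position q
position-cong                 refl here      here      = refl
position-cong {S = true ∷ S}  refl (there p) (there q) = cong suc (position-cong refl p q)
position-cong {S = false ∷ S} refl (there p) (there q) = position-cong refl p q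

nth-position : ∀ {n} {S : Subset n} {x} (p : x ∈ S) → nth S (position p) ≡ x
nth-position {S = true ∷ S}  here      = refl
nth-position {S = true ∷ S}  (there p) = cong suc (nth-position p)
nth-position {S = false ∷ S} (there p) = cong suc (nth-position p)

position-nth : ∀ {n} (S : Subset n) r (p : nth S r ∈ S) → position p ≡ r
position-nth (true ∷ S)  zero    here      = refl
position-nth (true ∷ S)  (suc r) (there p) = cong suc (position-nth S r p)
position-nth (false ∷ S) r       (there p) = position-nth S r p

nth-<ᵇ : ∀ {n} (S : Subset n) r t → nth S r <ᵇ nth S t ≡ r <ᵇ t
nth-<ᵇ (true ∷ S)  zero    zero    = refl
nth-<ᵇ (true ∷ S)  zero    (suc t) = refl
nth-<ᵇ (true ∷ S)  (suc r) zero    = refl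
nth-<ᵇ (true ∷ S)  (suc r) (suc t) = nth-<ᵇ S r t
nth-<ᵇ (false ∷ S) r       t       = nth-<ᵇ S r t

position-<ᵇ : ∀ {n} {S : Subset n} {x y} (p : x ∈ S) (q : y ∈ S) → position p <ᵇ position q ≡ x <ᵇ y
position-<ᵇ {S = S} p q =
  trans (sym (nth-<ᵇ S (position p) (position q))) (cong₂ _<ᵇ_ (nth-position p) (nth-position q))

-- A subset of S, given as a subset of Fin ∣ S ∣, viewed as a subset of Fin n.
embed : ∀ {n} (S : Subset n) → Subset ∣ S ∣ → Subset n
embed []          []      = []
embed (true ∷ S)  (a ∷ A) = a ∷ embed S A
embed (false ∷ S) A       = false ∷ embed S A

-- The trace I ∩ S of I on S, as a subset of Fin ∣ S ∣.
trace : ∀ {n} (S : Subset n) → Subset n → Subset ∣ S ∣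
trace []          []      = []
trace (true ∷ S)  (i ∷ I) = i ∷ trace S I
trace (false ∷ S) (i ∷ I) = trace S I

lookup-embed : ∀ {n} {S : Subset n} {x} A (p : x ∈ S) → lookup (embed S A) x ≡ lookup A (position p)
lookup-embed {S = true ∷ S}  (a ∷ A) here      = refl
lookup-embed {S = true ∷ S}  (a ∷ A) (there p) = lookup-embed A p
lookup-embed {S = false ∷ S} A       (there p) = lookup-embed A p

embed⊆ : ∀ {n} (S : Subset n) A → embed S A ⊆ S
embed⊆ (true ∷ S)  (true ∷ A) here      = here
embed⊆ (true ∷ S)  (a ∷ A)    (there p) = there (embed⊆ S A p)
embed⊆ (false ∷ S) A          (there p) = there (embed⊆ S A p)

embed-mono : ∀ {n} (S : Subset n) {A B} → A ⊆ B → embed S A ⊆ embed S B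
embed-mono (true ∷ S)  {true ∷ A} {true ∷ B} A⊆B here      = here
embed-mono (true ∷ S)  {a ∷ A}    {b ∷ B}    A⊆B (there p) = there (embed-mono S (drop-∷-⊆ A⊆B) p)
embed-mono (false ∷ S)                       A⊆B (there p) = there (embed-mono S A⊆B p)
embed-mono (true ∷ S)  {true ∷ A} {false ∷ B} A⊆B here with A⊆B here
... | ()

lookup-trace : ∀ {n} (S : Subset n) I r → lookup (trace S I) r ≡ lookup I (nth S r)
lookup-trace (true ∷ S)  (i ∷ I) zero    = refl
lookup-trace (true ∷ S)  (i ∷ I) (suc r) = lookup-trace S I r
lookup-trace (false ∷ S) (i ∷ I) r       = lookup-trace S I r

embed-trace : ∀ {n} (S : Subset n) I → embed S (trace S I) ≡ I ∩ S
embed-trace []          []      = refl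
embed-trace (true ∷ S)  (i ∷ I) = cong₂ _∷_ (sym (∧-identityʳ i)) (embed-trace S I)
embed-trace (false ∷ S) (i ∷ I) = cong₂ _∷_ (sym (∧-zeroʳ i)) (embed-trace S I)

trace-embed : ∀ {n} (S : Subset n) A → trace S (embed S A) ≡ A
trace-embed []          []      = refl
trace-embed (true ∷ S)  (a ∷ A) = cong (a ∷_) (trace-embed S A)
trace-embed (false ∷ S) A       = trace-embed S A

trace-mono : ∀ {n} (S : Subset n) {X Y} → X ⊆ Y → trace S X ⊆ trace S Y
trace-mono (true ∷ S)  {x ∷ X} {y ∷ Y} X⊆Y here      with X⊆Y here
... | here = here
trace-mono (true ∷ S)  {x ∷ X} {y ∷ Y} X⊆Y (there p) = there (trace-mono S (drop-∷-⊆ X⊆Y) p)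
trace-mono (false ∷ S) {x ∷ X} {y ∷ Y} X⊆Y p         = trace-mono S (drop-∷-⊆ X⊆Y) p

∣embed∣ : ∀ {n} (S : Subset n) A → ∣ embed S A ∣ ≡ ∣ A ∣
∣embed∣ []          []         = refl
∣embed∣ (true ∷ S)  (true ∷ A)  = cong suc (∣embed∣ S A)
∣embed∣ (true ∷ S)  (false ∷ A) = ∣embed∣ S A
∣embed∣ (false ∷ S) A           = ∣embed∣ S A

embed-⊥ʳ : ∀ {n} (S : Subset n) → embed S ⊥ ≡ ⊥
embed-⊥ʳ []          = refl
embed-⊥ʳ (true ∷ S)  = cong (false ∷_) (embed-⊥ʳ S)
embed-⊥ʳ (false ∷ S) = cong (false ∷_) (embed-⊥ʳ S)

embed-⁅⁆∪ : ∀ {n} {S : Subset n} {x} (p : x ∈ S) A → embed S (⁅ position p ⁆ ∪ A) ≡ ⁅ x ⁆ ∪ embed S A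
embed-⁅⁆∪ {S = true ∷ S}  here      (a ∷ A) =
  cong (true ∷_) (trans (cong (embed S) (∪-identityˡ A)) (sym (∪-identityˡ (embed S A))))
embed-⁅⁆∪ {S = true ∷ S}  (there p) (a ∷ A) = cong (a ∷_) (embed-⁅⁆∪ p A)
embed-⁅⁆∪ {S = false ∷ S} (there p) A       = cong (false ∷_) (embed-⁅⁆∪ p A)

∈embed⁺ : ∀ {n} {S : Subset n} {x} {A} (p : x ∈ S) → position p ∈ A → x ∈ embed S A
∈embed⁺ {A = A} p q = lookup⇒[]= _ _ (trans (lookup-embed A p) ([]=⇒lookup q))

∈embed⁻ : ∀ {n} {S : Subset n} {x} {A} (p : x ∈ S) → x ∈ embed S A → position p ∈ A
∈embed⁻ {A = A} p q = lookup⇒[]= _ _ (trans (sym (lookup-embed A p)) ([]=⇒lookup q))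

trace-∁ : ∀ {n} (S : Subset n) X → trace S (∁ X) ≡ ∁ (trace S X)
trace-∁ []          []      = refl
trace-∁ (true ∷ S)  (x ∷ X) = cong (not x ∷_) (trace-∁ S X)
trace-∁ (false ∷ S) (x ∷ X) = trace-∁ S X

trace-∁embed : ∀ {n} (S : Subset n) Y → trace S (∁ (embed S Y)) ≡ ∁ Y
trace-∁embed S Y = trans (trace-∁ S (embed S Y)) (cong ∁ (trace-embed S Y))

trace-self : ∀ {n} (S : Subset n) → trace S S ≡ ⊤
trace-self []          = refl
trace-self (true ∷ S)  = cong (true ∷_) (trace-self S)
trace-self (false ∷ S) = trace-self S

embed-∩-trace : ∀ {n} (S : Subset n) A X → embed S (A ∩ trace S X) ≡ embed S A ∩ X
embed-∩-trace []          []      []      = refl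
embed-∩-trace (true ∷ S)  (a ∷ A) (x ∷ X) = cong ((a ∧ x) ∷_) (embed-∩-trace S A X)
embed-∩-trace (false ∷ S) A       (x ∷ X) = cong (false ∷_) (embed-∩-trace S A X)

embed-trace-∩ : ∀ {n} (S : Subset n) I Y → embed S (trace S I ∩ Y) ≡ I ∩ embed S Y
embed-trace-∩ []          []      []      = refl
embed-trace-∩ (true ∷ S)  (i ∷ I) (y ∷ Y) = cong ((i ∧ y) ∷_) (embed-trace-∩ S I Y)
embed-trace-∩ (false ∷ S) (i ∷ I) Y       = cong₂ _∷_ (sym (∧-zeroʳ i)) (embed-trace-∩ S I Y)

embed-trace-∩∁ : ∀ {n} (S : Subset n) I Y → embed S (trace S I ∩ ∁ Y) ≡ (I ∩ ∁ (embed S Y)) ∩ S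
embed-trace-∩∁ []          []      []      = refl
embed-trace-∩∁ (true ∷ S)  (i ∷ I) (y ∷ Y) =
  cong₂ _∷_ (sym (∧-identityʳ (i ∧ not y))) (embed-trace-∩∁ S I Y)
embed-trace-∩∁ (false ∷ S) (i ∷ I) Y       = cong₂ _∷_ (sym (∧-zeroʳ (i ∧ true))) (embed-trace-∩∁ S I Y)

I∩∁embed∩∁S≡I∩∁S : ∀ {n} (S : Subset n) I Y → (I ∩ ∁ (embed S Y)) ∩ ∁ S ≡ I ∩ ∁ S
I∩∁embed∩∁S≡I∩∁S []          []      []      = refl
I∩∁embed∩∁S≡I∩∁S (true ∷ S)  (i ∷ I) (y ∷ Y) =
  cong₂ _∷_ (trans (∧-zeroʳ (i ∧ not y)) (sym (∧-zeroʳ i))) (I∩∁embed∩∁S≡I∩∁S S I Y)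
I∩∁embed∩∁S≡I∩∁S (false ∷ S) (i ∷ I) Y       =
  cong₂ _∷_ (∧-identityʳ (i ∧ true)) (I∩∁embed∩∁S≡I∩∁S S I Y)

⊆⇒∈trace : ∀ {n} {S X : Subset n} → S ⊆ X → ∀ r → r ∈ trace S X
⊆⇒∈trace {S = S} S⊆X r = trace-mono S S⊆X (subst (r ∈_) (sym (trace-self S)) ∈⊤)

lookup-embed-∉ : ∀ {n} {S : Subset n} {x} A → x ∉ S → lookup (embed S A) x ≡ false
lookup-embed-∉ {S = S} A x∉S = ∉⇒lookup≡false (x∉S ∘ embed⊆ S A)

∈trace⁺ : ∀ {n} {S X : Subset n} {x} (p : x ∈ S) → x ∈ X → position p ∈ trace S X
∈trace⁺ {S = S} {X} p x∈X =
  lookup⇒[]= _ _ (trans (lookup-trace S X _) (trans (cong (lookup X) (nth-position p)) ([]=⇒lookup x∈X)))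

∣trace∣≡∣∩∣ : ∀ {n} (T X : Subset n) → ∣ trace T X ∣ ≡ ∣ X ∩ T ∣
∣trace∣≡∣∩∣ []          []          = refl
∣trace∣≡∣∩∣ (true ∷ T)  (true ∷ X)  = cong suc (∣trace∣≡∣∩∣ T X)
∣trace∣≡∣∩∣ (true ∷ T)  (false ∷ X) = ∣trace∣≡∣∩∣ T X
∣trace∣≡∣∩∣ (false ∷ T) (x ∷ X)     = trans (∣trace∣≡∣∩∣ T X) (cong (λ b → ∣ b ∷ X ∩ T ∣) (sym (∧-zeroʳ x)))

∣trace∣ : ∀ {n} {S C : Subset n} → C ⊆ S → ∣ trace S C ∣ ≡ ∣ C ∣
∣trace∣ {S = S} {C} C⊆S = trans (∣trace∣≡∣∩∣ S C) (cong ∣_∣ (p⊆q⇒p∩q≡p C⊆S))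

∣∣+∣trace∁∣ : ∀ {n} {S C : Subset n} → C ⊆ S → ∣ C ∣ + ∣ trace (∁ C) S ∣ ≡ ∣ S ∣
∣∣+∣trace∁∣ {S = []}        {[]}        C⊆S = refl
∣∣+∣trace∁∣ {S = true ∷ S}  {true ∷ C}  C⊆S = cong suc (∣∣+∣trace∁∣ (drop-∷-⊆ C⊆S))
∣∣+∣trace∁∣ {S = true ∷ S}  {false ∷ C} C⊆S = trans (ℕₚ.+-suc _ _) (cong suc (∣∣+∣trace∁∣ (drop-∷-⊆ C⊆S)))
∣∣+∣trace∁∣ {S = false ∷ S} {false ∷ C} C⊆S = ∣∣+∣trace∁∣ (drop-∷-⊆ C⊆S)
∣∣+∣trace∁∣ {S = false ∷ S} {true ∷ C}  C⊆S with C⊆S here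
... | ()

-- Both sides are the sign of the shuffle of Fin n into the order C , S ∖ C , ∁ S.
crossingSign-⊆ : ∀ {n} {S C : Subset n} → C ⊆ S →
  crossingSign C *ˢ crossingSign (trace (∁ C) S) ≡ crossingSign S *ˢ crossingSign (trace S C)
crossingSign-⊆ {S = []}        {[]}        C⊆S = refl
crossingSign-⊆ {S = true ∷ S}  {true ∷ C}  C⊆S = crossingSign-⊆ (drop-∷-⊆ C⊆S)
crossingSign-⊆ {S = true ∷ S}  {false ∷ C} C⊆S = begin
  (paritySign ∣ C ∣ *ˢ crossingSign C) *ˢ crossingSign (trace (∁ C) S)
    ≡⟨ Signₚ.*-assoc (paritySign ∣ C ∣) _ _ ⟩
  paritySign ∣ C ∣ *ˢ (crossingSign C *ˢ crossingSign (trace (∁ C) S))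
    ≡⟨ cong (paritySign ∣ C ∣ *ˢ_) (crossingSign-⊆ (drop-∷-⊆ C⊆S)) ⟩
  paritySign ∣ C ∣ *ˢ (crossingSign S *ˢ crossingSign (trace S C))
    ≡⟨ x∙yz≈y∙xz (paritySign ∣ C ∣) (crossingSign S) _ ⟩
  crossingSign S *ˢ (paritySign ∣ C ∣ *ˢ crossingSign (trace S C))
    ≡⟨ cong (λ k → crossingSign S *ˢ (paritySign k *ˢ crossingSign (trace S C))) (sym (∣trace∣ (drop-∷-⊆ C⊆S))) ⟩
  crossingSign S *ˢ (paritySign ∣ trace S C ∣ *ˢ crossingSign (trace S C)) ∎
  where open ≡-Reasoning
crossingSign-⊆ {S = false ∷ S} {false ∷ C} C⊆S = begin
  (paritySign ∣ C ∣ *ˢ crossingSign C) *ˢ (paritySign ∣ trace (∁ C) S ∣ *ˢ crossingSign (trace (∁ C) S))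
    ≡⟨ interchange (paritySign ∣ C ∣) _ _ _ ⟩
  (paritySign ∣ C ∣ *ˢ paritySign ∣ trace (∁ C) S ∣) *ˢ (crossingSign C *ˢ crossingSign (trace (∁ C) S))
    ≡⟨ cong₂ _*ˢ_ (trans (sym (paritySign-+ ∣ C ∣ _)) (cong paritySign (∣∣+∣trace∁∣ (drop-∷-⊆ C⊆S))))
                  (crossingSign-⊆ (drop-∷-⊆ C⊆S)) ⟩
  paritySign ∣ S ∣ *ˢ (crossingSign S *ˢ crossingSign (trace S C))
    ≡⟨ sym (Signₚ.*-assoc (paritySign ∣ S ∣) _ _) ⟩
  (paritySign ∣ S ∣ *ˢ crossingSign S) *ˢ crossingSign (trace S C) ∎
  where open ≡-Reasoning
crossingSign-⊆ {S = false ∷ S} {true ∷ C}  C⊆S with C⊆S here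
... | ()

-- Moving ∁ S rather than S to the front differs by swapping the two blocks.
crossingSign-∁ : ∀ {n} (S : Subset n) → crossingSign (∁ S) *ˢ paritySign (∣ ∁ S ∣ * ∣ S ∣) ≡ crossingSign S
crossingSign-∁ []          = refl
crossingSign-∁ (true ∷ S)  = begin
  (paritySign t *ˢ crossingSign (∁ S)) *ˢ paritySign (t * suc s)
    ≡⟨ cong (λ k → (paritySign t *ˢ crossingSign (∁ S)) *ˢ paritySign k) (ℕₚ.*-suc t s) ⟩
  (paritySign t *ˢ crossingSign (∁ S)) *ˢ paritySign (t + t * s)
    ≡⟨ cong ((paritySign t *ˢ crossingSign (∁ S)) *ˢ_) (paritySign-+ t (t * s)) ⟩
  (paritySign t *ˢ crossingSign (∁ S)) *ˢ (paritySign t *ˢ paritySign (t * s))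
    ≡⟨ interchange (paritySign t) _ _ _ ⟩
  (paritySign t *ˢ paritySign t) *ˢ (crossingSign (∁ S) *ˢ paritySign (t * s))
    ≡⟨ cong (_*ˢ (crossingSign (∁ S) *ˢ paritySign (t * s))) (Signₚ.s*s≡+ (paritySign t)) ⟩
  crossingSign (∁ S) *ˢ paritySign (t * s)
    ≡⟨ crossingSign-∁ S ⟩
  crossingSign S ∎
  where
  open ≡-Reasoning
  t = ∣ ∁ S ∣
  s = ∣ S ∣
crossingSign-∁ (false ∷ S) = begin
  crossingSign (∁ S) *ˢ paritySign (s + t * s)
    ≡⟨ cong (crossingSign (∁ S) *ˢ_) (paritySign-+ s (t * s)) ⟩
  crossingSign (∁ S) *ˢ (paritySign s *ˢ paritySign (t * s))
    ≡⟨ x∙yz≈y∙xz (crossingSign (∁ S)) (paritySign s) _ ⟩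
  paritySign s *ˢ (crossingSign (∁ S) *ˢ paritySign (t * s))
    ≡⟨ cong (paritySign s *ˢ_) (crossingSign-∁ S) ⟩
  paritySign s *ˢ crossingSign S ∎
  where
  open ≡-Reasoning
  t = ∣ ∁ S ∣
  s = ∣ S ∣

-- Restriction, separators and the component of zero

-- The proofs of the matroid axioms of M ↾ S are opaque, so that the typechecker never unfolds them
-- when comparing restrictions.
opaque
  ↾-indep-∅ : ∀ {n} (M : Matroid n) S → indep M (embed S ⊥) ≡ true
  ↾-indep-∅ M S = trans (cong (indep M) (embed-⊥ʳ S)) (indep-∅ M)

  ↾-indep-↓ : ∀ {n} (M : Matroid n) S A B → A ⊆ B → indep M (embed S B) ≡ true → indep M (embed S A) ≡ true
  ↾-indep-↓ M S A B A⊆B = indep-↓ M (embed S A) (embed S B) (embed-mono S A⊆B)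

  ↾-indep-aug : ∀ {n} (M : Matroid n) S A B → indep M (embed S A) ≡ true → indep M (embed S B) ≡ true →
                ∣ A ∣ < ∣ B ∣ → ∃ λ x → x ∈ B × x ∉ A × indep M (embed S (⁅ x ⁆ ∪ A)) ≡ true
  ↾-indep-aug M S A B iA iB ∣A∣<∣B∣ with indep-aug M (embed S A) (embed S B) iA iB
                                          (subst₂ _<_ (sym (∣embed∣ S A)) (sym (∣embed∣ S B)) ∣A∣<∣B∣)
  ... | x , x∈B , x∉A , iA+x = position x∈S , ∈embed⁻ x∈S x∈B , (λ r∈A → x∉A (∈embed⁺ x∈S r∈A)) ,
                               trans (cong (indep M) (embed-⁅⁆∪ x∈S A)) iA+x
    where
    x∈S : x ∈ S
    x∈S = embed⊆ S B x∈B

infixl 8 _↾_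
_↾_ : ∀ {n} → Matroid n → (S : Subset n) → Matroid ∣ S ∣
M ↾ S = record
  { indep     = λ A → indep M (embed S A)
  ; indep-∅   = ↾-indep-∅ M S
  ; indep-↓   = ↾-indep-↓ M S
  ; indep-aug = ↾-indep-aug M S
  }

Separator : ∀ {n} → Matroid n → Subset n → Set
Separator M S = ∀ I → indep M I ≡ (indep M (I ∩ S) ∧ indep M (I ∩ ∁ S))

separator? : ∀ {n} (M : Matroid n) → Decidable (Separator M)
separator? M S = allSubsets? λ I → indep M I Boolₚ.≟ (indep M (I ∩ S) ∧ indep M (I ∩ ∁ S))

I∩∁[S∩T]∩S≡I∩S∩∁T : ∀ {n} (I S T : Subset n) → (I ∩ ∁ (S ∩ T)) ∩ S ≡ (I ∩ S) ∩ ∁ T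
I∩∁[S∩T]∩S≡I∩S∩∁T []      []      []      = refl
I∩∁[S∩T]∩S≡I∩S∩∁T (i ∷ I) (s ∷ S) (t ∷ T) = cong₂ _∷_ (bit i s t) (I∩∁[S∩T]∩S≡I∩S∩∁T I S T)
  where
  bit : ∀ i s t → (i ∧ not (s ∧ t)) ∧ s ≡ (i ∧ s) ∧ not t
  bit true  true  t = ∧-identityʳ (not t)
  bit true  false t = refl
  bit false s     t = refl

I∩∁[S∩T]∩∁S≡I∩∁S : ∀ {n} (I S T : Subset n) → (I ∩ ∁ (S ∩ T)) ∩ ∁ S ≡ I ∩ ∁ S
I∩∁[S∩T]∩∁S≡I∩∁S []      []      []      = refl
I∩∁[S∩T]∩∁S≡I∩∁S (i ∷ I) (s ∷ S) (t ∷ T) = cong₂ _∷_ (bit i s t) (I∩∁[S∩T]∩∁S≡I∩∁S I S T)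
  where
  bit : ∀ i s t → (i ∧ not (s ∧ t)) ∧ not s ≡ i ∧ not s
  bit true  true  t = ∧-zeroʳ (not t)
  bit true  false t = refl
  bit false s     t = refl

module _ {n} (M : Matroid n) where
  open ≡-Reasoning

  Separator-⊤ : Separator M ⊤
  Separator-⊤ I = sym (begin
    indep M (I ∩ ⊤) ∧ indep M (I ∩ ∁ ⊤)
      ≡⟨ cong₂ _∧_ (cong (indep M) (∩-identityʳ I)) (cong (indep M) (trans (cong (I ∩_) ∁⊤) (∩-zeroʳ I))) ⟩
    indep M I ∧ indep M ⊥
      ≡⟨ cong (indep M I ∧_) (indep-∅ M) ⟩
    indep M I ∧ true
      ≡⟨ ∧-identityʳ _ ⟩
    indep M I ∎)

  Separator-∁ : ∀ {S} → Separator M S → Separator M (∁ S)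
  Separator-∁ {S} sepS I = trans (sepS I) (trans (∧-comm (indep M (I ∩ S)) _)
    (cong (indep M (I ∩ ∁ S) ∧_) (cong (indep M) (cong (I ∩_) (sym (∁-involutive S))))))

  Separator-∩ : ∀ {S T} → Separator M S → Separator M T → Separator M (S ∩ T)
  Separator-∩ {S} {T} sepS sepT I = begin
    indep M I
      ≡⟨ sepS I ⟩
    indep M (I ∩ S) ∧ indep M (I ∩ ∁ S)
      ≡⟨ cong (_∧ indep M (I ∩ ∁ S)) (sepT (I ∩ S)) ⟩
    (indep M ((I ∩ S) ∩ T) ∧ indep M ((I ∩ S) ∩ ∁ T)) ∧ indep M (I ∩ ∁ S)
      ≡⟨ ∧-assoc (indep M ((I ∩ S) ∩ T)) _ _ ⟩
    indep M ((I ∩ S) ∩ T) ∧ (indep M ((I ∩ S) ∩ ∁ T) ∧ indep M (I ∩ ∁ S))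
      ≡⟨ cong₂ _∧_ (cong (indep M) (∩-assoc I S T)) (sym outside-S∩T) ⟩
    indep M (I ∩ (S ∩ T)) ∧ indep M (I ∩ ∁ (S ∩ T)) ∎
    where
    outside-S∩T : indep M (I ∩ ∁ (S ∩ T)) ≡ (indep M ((I ∩ S) ∩ ∁ T) ∧ indep M (I ∩ ∁ S))
    outside-S∩T = trans (sepS _) (cong₂ _∧_ (cong (indep M) (I∩∁[S∩T]∩S≡I∩S∩∁T I S T))
                                            (cong (indep M) (I∩∁[S∩T]∩∁S≡I∩∁S I S T)))

  Separator-trace : ∀ S {X} → Separator M X → Separator (M ↾ S) (trace S X)
  Separator-trace S {X} sepX I = begin
    indep M (embed S I)
      ≡⟨ sepX (embed S I) ⟩
    indep M (embed S I ∩ X) ∧ indep M (embed S I ∩ ∁ X)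
      ≡⟨ sym (cong₂ _∧_ (cong (indep M) (embed-∩-trace S I X)) (cong (indep M) embed-∩∁trace)) ⟩
    indep M (embed S (I ∩ trace S X)) ∧ indep M (embed S (I ∩ ∁ (trace S X))) ∎
    where
    embed-∩∁trace : embed S (I ∩ ∁ (trace S X)) ≡ embed S I ∩ ∁ X
    embed-∩∁trace = trans (cong (λ Z → embed S (I ∩ Z)) (sym (trace-∁ S X))) (embed-∩-trace S I (∁ X))

  Separator-embed : ∀ {S Y} → Separator M S → Separator (M ↾ S) Y → Separator M (embed S Y)
  Separator-embed {S} {Y} sepS sepY I = begin
    indep M I
      ≡⟨ sepS I ⟩
    indep M (I ∩ S) ∧ indep M (I ∩ ∁ S)
      ≡⟨ cong (λ Z → indep M Z ∧ indep M (I ∩ ∁ S)) (sym (embed-trace S I)) ⟩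
    indep M (embed S (trace S I)) ∧ indep M (I ∩ ∁ S)
      ≡⟨ cong (_∧ indep M (I ∩ ∁ S)) (sepY (trace S I)) ⟩
    (indep M (embed S (trace S I ∩ Y)) ∧ indep M (embed S (trace S I ∩ ∁ Y))) ∧ indep M (I ∩ ∁ S)
      ≡⟨ cong (_∧ indep M (I ∩ ∁ S)) (cong₂ _∧_ (cong (indep M) (embed-trace-∩ S I Y))
                                                 (cong (indep M) (embed-trace-∩∁ S I Y))) ⟩
    (indep M (I ∩ E) ∧ indep M ((I ∩ ∁ E) ∩ S)) ∧ indep M (I ∩ ∁ S)
      ≡⟨ ∧-assoc (indep M (I ∩ E)) _ _ ⟩
    indep M (I ∩ E) ∧ (indep M ((I ∩ ∁ E) ∩ S) ∧ indep M (I ∩ ∁ S))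
      ≡⟨ cong (indep M (I ∩ E) ∧_) (sym outside-E) ⟩
    indep M (I ∩ E) ∧ indep M (I ∩ ∁ E) ∎
    where
    E = embed S Y
    outside-E : indep M (I ∩ ∁ E) ≡ (indep M ((I ∩ ∁ E) ∩ S) ∧ indep M (I ∩ ∁ S))
    outside-E = trans (sepS _) (cong (indep M ((I ∩ ∁ E) ∩ S) ∧_) (cong (indep M) (I∩∁embed∩∁S≡I∩∁S S I Y)))

⋂ : ∀ {n m} → (Subset n → Subset m) → Subset m
⋂ {zero}  F = F []
⋂ {suc n} F = ⋂ (λ S → F (true ∷ S)) ∩ ⋂ (λ S → F (false ∷ S))

⋂⊆ : ∀ {n m} (F : Subset n → Subset m) S → ⋂ F ⊆ F S
⋂⊆ {zero}  F []          = λ x∈ → x∈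
⋂⊆ {suc n} F (true ∷ S)  = ⋂⊆ (λ S → F (true ∷ S)) S ∘ p∩q⊆p _ _
⋂⊆ {suc n} F (false ∷ S) = ⋂⊆ (λ S → F (false ∷ S)) S ∘ p∩q⊆q _ _

⋂-closed : ∀ {n m} (P : Subset m → Set) → (∀ {A B} → P A → P B → P (A ∩ B)) →
           (F : Subset n → Subset m) → (∀ S → P (F S)) → P (⋂ F)
⋂-closed {zero}  P P-∩ F PF = PF []
⋂-closed {suc n} P P-∩ F PF =
  P-∩ (⋂-closed P P-∩ _ (λ S → PF (true ∷ S))) (⋂-closed P P-∩ _ (λ S → PF (false ∷ S)))

record IsComponent₀ {n} (M : Matroid (suc n)) (C : Subset (suc n)) : Set where
  field
    separator : Separator M C
    zero∈     : zero ∈ C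
    minimal   : ∀ {S} → Separator M S → zero ∈ S → C ⊆ S

module _ {n} (M : Matroid (suc n)) where

  private
    candidate : Subset (suc n) → Subset (suc n)
    candidate S with separator? M S ×-dec zero ∈? S
    ... | yes _ = S
    ... | no  _ = ⊤

    candidate-separator : ∀ S → Separator M (candidate S)
    candidate-separator S with separator? M S ×-dec zero ∈? S
    ... | yes (sepS , _) = sepS
    ... | no  _          = Separator-⊤ M

    zero∈candidate : ∀ S → zero ∈ candidate S
    zero∈candidate S with separator? M S ×-dec zero ∈? S
    ... | yes (_ , 0∈S) = 0∈S
    ... | no  _         = ∈⊤

    candidate-fixed : ∀ {S} → Separator M S → zero ∈ S → candidate S ≡ S
    candidate-fixed {S} sepS 0∈S with separator? M S ×-dec zero ∈? S
    ... | yes _ = refl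
    ... | no ¬p = contradiction (sepS , 0∈S) ¬p

  -- Opaque: only the characterisation component₀-isComponent₀ is ever needed, and unfolding ⋂
  -- would enumerate all subsets.
  opaque
    component₀ : Subset (suc n)
    component₀ = ⋂ candidate

    component₀-isComponent₀ : IsComponent₀ M component₀
    component₀-isComponent₀ = record
      { separator = ⋂-closed (Separator M) (Separator-∩ M) candidate candidate-separator
      ; zero∈     = ⋂-closed (zero ∈_) (λ p q → x∈p∩q⁺ (p , q)) candidate zero∈candidate
      ; minimal   = λ {S} sepS 0∈S → subst (component₀ ⊆_) (candidate-fixed sepS 0∈S) (⋂⊆ candidate S)
      }

IsComponent₀-unique : ∀ {n} {M : Matroid (suc n)} {C D} → IsComponent₀ M C → IsComponent₀ M D → C ≡ D
IsComponent₀-unique isC isD = ⊆-antisym (C.minimal D.separator D.zero∈) (D.minimal C.separator C.zero∈)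
  where
  module C = IsComponent₀ isC
  module D = IsComponent₀ isD

IsComponent₀-connected : ∀ {n} {M : Matroid (suc n)} {C} → IsComponent₀ M C → Connected (M ↾ C)
IsComponent₀-connected {M = M} {C} isC = >-nonZero⁻¹ ∣ C ∣ {{nonZeroIndex (position zero∈)}} , no-split
  where
  open IsComponent₀ isC
  no-split : ¬ Σ (Subset ∣ C ∣) λ Y → Nonempty Y × Nonempty (∁ Y) × Separator (M ↾ C) Y
  no-split (Y , (f , f∈Y) , (g , g∈∁Y) , sepY) with position zero∈ ∈? Y
  ... | yes 0∈Y = x∈∁p⇒x∉p g∈∁Y (subst (g ∈_) (trace-embed C Y) (⊆⇒∈trace C⊆E g))
    where
    C⊆E : C ⊆ embed C Y
    C⊆E = minimal (Separator-embed M separator sepY) (∈embed⁺ zero∈ 0∈Y)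
  ... | no  0∉Y = x∈∁p⇒x∉p (subst (f ∈_) (trace-∁embed C Y) (⊆⇒∈trace C⊆∁E f)) f∈Y
    where
    C⊆∁E : C ⊆ ∁ (embed C Y)
    C⊆∁E = minimal (Separator-∁ M (Separator-embed M separator sepY))
                   (x∉p⇒x∈∁p (λ 0∈E → 0∉Y (∈embed⁻ zero∈ 0∈E)))

IsComponent₀-↾ : ∀ {n} {M : Matroid (suc n)} {C S} → IsComponent₀ M C → Separator M (true ∷ S) →
                 IsComponent₀ (M ↾ (true ∷ S)) (trace (true ∷ S) C)
IsComponent₀-↾ {M = M} {C} {S} isC sepS = record
  { separator = Separator-trace M (true ∷ S) separator
  ; zero∈     = ∈trace⁺ here zero∈
  ; minimal   = λ {Y} sepY 0∈Y → subst (trace (true ∷ S) C ⊆_) (trace-embed (true ∷ S) Y)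
      (trace-mono (true ∷ S) (minimal (Separator-embed M sepS sepY) (∈embed⁺ here 0∈Y)))
  }
  where open IsComponent₀ isC

component₀-connected : ∀ {n} (M : Matroid (suc n)) → Connected (M ↾ component₀ M)
component₀-connected M = IsComponent₀-connected (component₀-isComponent₀ M)

connected⇒component₀≡⊤ : ∀ {n} (M : Matroid (suc n)) → Connected M → component₀ M ≡ ⊤
connected⇒component₀≡⊤ M (_ , no-split) = ⊆-antisym ⊆⊤ (λ {x} _ → everywhere x)
  where
  open IsComponent₀ (component₀-isComponent₀ M)
  everywhere : ∀ x → x ∈ component₀ M
  everywhere x with x ∈? component₀ M
  ... | yes x∈C = x∈C
  ... | no  x∉C = contradiction (component₀ M , (zero , zero∈) , (x , x∉p⇒x∈∁p x∉C) , separator) no-split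

∣∁component₀∣< : ∀ {n} (M : Matroid (suc n)) → ∣ ∁ (component₀ M) ∣ < suc n
∣∁component₀∣< M = ℕₚ.≤-trans (ℕₚ.+-monoˡ-≤ _ (proj₁ (component₀-connected M)))
                              (ℕₚ.≤-reflexive (∣∣+∣∁∣ (component₀ M)))

Separator-≗ : ∀ {n} {M N : Matroid n} → (∀ A → indep M A ≡ indep N A) → ∀ {S} → Separator M S → Separator N S
Separator-≗ M≗N sepS I = trans (sym (M≗N I)) (trans (sepS I) (cong₂ _∧_ (M≗N _) (M≗N _)))

-- Transport along bijections

image′ : ∀ {a b} → Permutation a b → Subset a → Subset b
image′ ψ S = tabulate (λ j → lookup S (ψ ⟨$⟩ˡ j))

IsIso′ : ∀ {a b} → Permutation a b → Matroid a → Matroid b → Set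
IsIso′ ψ M M' = ∀ S → indep M' (image′ ψ S) ≡ indep M S

lookup-image′ : ∀ {a b} (ψ : Permutation a b) S j → lookup (image′ ψ S) j ≡ lookup S (ψ ⟨$⟩ˡ j)
lookup-image′ ψ S = lookup∘tabulate _

image′-flip : ∀ {a b} (ψ : Permutation a b) S → image′ (flip ψ) (image′ ψ S) ≡ S
image′-flip ψ S = lookup-ext λ i →
  trans (lookup-image′ (flip ψ) (image′ ψ S) i)
        (trans (lookup-image′ ψ S (ψ ⟨$⟩ʳ i)) (cong (lookup S) (inverseˡ ψ)))

count : Bool → ℕ
count true  = 1
count false = 0

∣∣-∑ : ∀ {n} (S : Subset n) → ∣ S ∣ ≡ ∑ (count ∘ lookup S)
∣∣-∑ []          = refl
∣∣-∑ (true ∷ S)  = cong suc (∣∣-∑ S)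
∣∣-∑ (false ∷ S) = ∣∣-∑ S

module _ {a b} (ψ : Permutation a b) where

  image′-∩ : ∀ A B → image′ ψ (A ∩ B) ≡ image′ ψ A ∩ image′ ψ B
  image′-∩ A B = lookup-ext λ j → begin
    lookup (image′ ψ (A ∩ B)) j                 ≡⟨ lookup-image′ ψ (A ∩ B) j ⟩
    lookup (A ∩ B) (ψ ⟨$⟩ˡ j)                    ≡⟨ lookup-zipWith _∧_ _ A B ⟩
    lookup A (ψ ⟨$⟩ˡ j) ∧ lookup B (ψ ⟨$⟩ˡ j)     ≡⟨ sym (cong₂ _∧_ (lookup-image′ ψ A j) (lookup-image′ ψ B j)) ⟩
    lookup (image′ ψ A) j ∧ lookup (image′ ψ B) j ≡⟨ sym (lookup-zipWith _∧_ j (image′ ψ A) (image′ ψ B)) ⟩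
    lookup (image′ ψ A ∩ image′ ψ B) j ∎
    where open ≡-Reasoning

  image′-∪ : ∀ A B → image′ ψ (A ∪ B) ≡ image′ ψ A ∪ image′ ψ B
  image′-∪ A B = lookup-ext λ j → begin
    lookup (image′ ψ (A ∪ B)) j                 ≡⟨ lookup-image′ ψ (A ∪ B) j ⟩
    lookup (A ∪ B) (ψ ⟨$⟩ˡ j)                    ≡⟨ lookup-zipWith _∨_ _ A B ⟩
    lookup A (ψ ⟨$⟩ˡ j) ∨ lookup B (ψ ⟨$⟩ˡ j)     ≡⟨ sym (cong₂ _∨_ (lookup-image′ ψ A j) (lookup-image′ ψ B j)) ⟩
    lookup (image′ ψ A) j ∨ lookup (image′ ψ B) j ≡⟨ sym (lookup-zipWith _∨_ j (image′ ψ A) (image′ ψ B)) ⟩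
    lookup (image′ ψ A ∪ image′ ψ B) j ∎
    where open ≡-Reasoning

  image′-∁ : ∀ A → image′ ψ (∁ A) ≡ ∁ (image′ ψ A)
  image′-∁ A = lookup-ext λ j → begin
    lookup (image′ ψ (∁ A)) j    ≡⟨ lookup-image′ ψ (∁ A) j ⟩
    lookup (∁ A) (ψ ⟨$⟩ˡ j)       ≡⟨ lookup-map _ not A ⟩
    not (lookup A (ψ ⟨$⟩ˡ j))     ≡⟨ sym (cong not (lookup-image′ ψ A j)) ⟩
    not (lookup (image′ ψ A) j)  ≡⟨ sym (lookup-map j not (image′ ψ A)) ⟩
    lookup (∁ (image′ ψ A)) j ∎
    where open ≡-Reasoning

  image′-⊥ : image′ ψ ⊥ ≡ ⊥
  image′-⊥ = lookup-ext λ j →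
    trans (lookup-image′ ψ ⊥ j) (trans (lookup-replicate (ψ ⟨$⟩ˡ j) false) (sym (lookup-replicate j false)))

  ∈image′⁺ : ∀ {S x} → x ∈ S → ψ ⟨$⟩ʳ x ∈ image′ ψ S
  ∈image′⁺ {S} {x} x∈S = lookup⇒[]= _ _
    (trans (lookup-image′ ψ S _) (trans (cong (lookup S) (inverseˡ ψ)) ([]=⇒lookup x∈S)))

  ∈image′⁻ : ∀ {S y} → y ∈ image′ ψ S → ψ ⟨$⟩ˡ y ∈ S
  ∈image′⁻ {S} {y} y∈ψS = lookup⇒[]= _ _ (trans (sym (lookup-image′ ψ S y)) ([]=⇒lookup y∈ψS))

  image′-mono : ∀ {A B} → A ⊆ B → image′ ψ A ⊆ image′ ψ B
  image′-mono A⊆B y∈ψA = subst (_∈ _) (inverseʳ ψ) (∈image′⁺ (A⊆B (∈image′⁻ y∈ψA)))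

  image′-⁅⁆ : ∀ x → image′ ψ ⁅ x ⁆ ≡ ⁅ ψ ⟨$⟩ʳ x ⁆
  image′-⁅⁆ x = ⊆-antisym
    (λ y∈ψx → subst (_∈ ⁅ ψ ⟨$⟩ʳ x ⁆) (trans (cong (ψ ⟨$⟩ʳ_) (sym (x∈⁅y⁆⇒x≡y x (∈image′⁻ y∈ψx)))) (inverseʳ ψ))
                   (x∈⁅x⁆ (ψ ⟨$⟩ʳ x)))
    (λ {y} y∈ψx → subst (_∈ image′ ψ ⁅ x ⁆) (sym (x∈⁅y⁆⇒x≡y _ y∈ψx)) (∈image′⁺ (x∈⁅x⁆ x)))

  IsIso′-flip : ∀ {M M'} → IsIso′ ψ M M' → IsIso′ (flip ψ) M' M
  IsIso′-flip {M} {M'} ψ-iso S = trans (sym (ψ-iso _)) (cong (indep M') (image′-flip (flip ψ) S))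

  ∣image′∣ : ∀ S → ∣ image′ ψ S ∣ ≡ ∣ S ∣
  ∣image′∣ S = begin
    ∣ image′ ψ S ∣                     ≡⟨ ∣∣-∑ (image′ ψ S) ⟩
    ∑ (count ∘ lookup (image′ ψ S))   ≡⟨ ∑-cong (cong count ∘ lookup-image′ ψ S) ⟩
    ∑ (count ∘ lookup S ∘ (ψ ⟨$⟩ˡ_))   ≡⟨ sym (∑-permute (count ∘ lookup S) (flip ψ)) ⟩
    ∑ (count ∘ lookup S)              ≡⟨ sym (∣∣-∑ S) ⟩
    ∣ S ∣ ∎
    where open ≡-Reasoning

  Separator-image′ : ∀ {M M'} → IsIso′ ψ M M' → ∀ {S} → Separator M S → Separator M' (image′ ψ S)
  Separator-image′ {M} {M'} ψ-iso {S} sepS I = begin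
    indep M' I
      ≡⟨ cong (indep M') (sym (image′-flip (flip ψ) I)) ⟩
    indep M' (image′ ψ J)
      ≡⟨ ψ-iso J ⟩
    indep M J
      ≡⟨ sepS J ⟩
    indep M (J ∩ S) ∧ indep M (J ∩ ∁ S)
      ≡⟨ sym (cong₂ _∧_ (ψ-iso (J ∩ S)) (ψ-iso (J ∩ ∁ S))) ⟩
    indep M' (image′ ψ (J ∩ S)) ∧ indep M' (image′ ψ (J ∩ ∁ S))
      ≡⟨ cong₂ _∧_ (cong (indep M') (trans (image′-∩ J S) (cong (_∩ image′ ψ S) (image′-flip (flip ψ) I))))
                   (cong (indep M') (trans (image′-∩ J (∁ S)) (cong₂ _∩_ (image′-flip (flip ψ) I) (image′-∁ S)))) ⟩
    indep M' (I ∩ image′ ψ S) ∧ indep M' (I ∩ ∁ (image′ ψ S)) ∎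
    where
    open ≡-Reasoning
    J = image′ (flip ψ) I

permuteᴹ : ∀ {a b} → Permutation a b → Matroid a → Matroid b
permuteᴹ ψ M = record
  { indep     = λ S → indep M (image′ (flip ψ) S)
  ; indep-∅   = trans (cong (indep M) (image′-⊥ (flip ψ))) (indep-∅ M)
  ; indep-↓   = λ A B A⊆B → indep-↓ M _ _ (image′-mono (flip ψ) A⊆B)
  ; indep-aug = augment
  }
  where
  augment : ∀ A B → indep M (image′ (flip ψ) A) ≡ true → indep M (image′ (flip ψ) B) ≡ true → ∣ A ∣ < ∣ B ∣ →
            ∃ λ y → y ∈ B × y ∉ A × indep M (image′ (flip ψ) (⁅ y ⁆ ∪ A)) ≡ true
  augment A B iA iB ∣A∣<∣B∣ with indep-aug M _ _ iA iB
    (subst₂ _<_ (sym (∣image′∣ (flip ψ) A)) (sym (∣image′∣ (flip ψ) B)) ∣A∣<∣B∣)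
  ... | x , x∈B , x∉A , iA+x =
    ψ ⟨$⟩ʳ x , ∈image′⁻ (flip ψ) x∈B , (λ ψx∈A → x∉A (subst (_∈ _) (inverseˡ ψ) (∈image′⁺ (flip ψ) ψx∈A))) ,
    trans (cong (indep M) (trans (image′-∪ (flip ψ) ⁅ ψ ⟨$⟩ʳ x ⁆ A)
                               (cong (_∪ image′ (flip ψ) A) (trans (image′-⁅⁆ (flip ψ) _) (cong ⁅_⁆ (inverseˡ ψ))))))
          iA+x

permuteᴹ-iso : ∀ {a b} (ψ : Permutation a b) M → IsIso′ ψ M (permuteᴹ ψ M)
permuteᴹ-iso ψ M S = cong (indep M) (image′-flip ψ S)

Connected-iso : ∀ {a b} (ψ : Permutation a b) {M M'} → IsIso′ ψ M M' → Connected M → Connected M'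
Connected-iso {a} {b} ψ {M} {M'} ψ-iso (1≤a , no-split) = subst (1 ≤_) (Perm.↔⇒≡ ψ) 1≤a , no-split′
  where
  no-split′ : ¬ Σ (Subset b) λ Y → Nonempty Y × Nonempty (∁ Y) × Separator M' Y
  no-split′ (Y , (f , f∈Y) , (g , g∈∁Y) , sepY) = no-split
    ( image′ (flip ψ) Y
    , (ψ ⟨$⟩ˡ f , ∈image′⁺ (flip ψ) f∈Y)
    , (ψ ⟨$⟩ˡ g , subst (_ ∈_) (image′-∁ (flip ψ) Y) (∈image′⁺ (flip ψ) g∈∁Y))
    , Separator-image′ (flip ψ) {M'} {M} (IsIso′-flip ψ {M} {M'} ψ-iso) sepY )

image′-id : ∀ {n} (S : Subset n) → image′ Perm.id S ≡ S
image′-id S = lookup-ext (lookup-image′ Perm.id S)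

module _ {a b} (ψ : Permutation a b) (S : Subset a) where

  private
    T = image′ ψ S

    to : Fin ∣ S ∣ → Fin ∣ T ∣
    to r = position (∈image′⁺ ψ (nth∈ S r))

    from : Fin ∣ T ∣ → Fin ∣ S ∣
    from u = position (∈image′⁻ ψ {S} (nth∈ T u))

    to-from : ∀ u → to (from u) ≡ u
    to-from u = trans (position-cong (trans (cong (ψ ⟨$⟩ʳ_) (nth-position _)) (inverseʳ ψ)) _ (nth∈ T u))
                      (position-nth T u _)

    from-to : ∀ r → from (to r) ≡ r
    from-to r = trans (position-cong (trans (cong (ψ ⟨$⟩ˡ_) (nth-position _)) (inverseˡ ψ)) _ (nth∈ S r))
                      (position-nth S r _)

  -- ψ restricted to S, with S and ψ(S) both renumbered in increasing order.
  restrictᵖ : Permutation ∣ S ∣ ∣ image′ ψ S ∣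
  restrictᵖ = permutation to from to-from from-to

  restrictᵖ-<ᵇ : ∀ r t → (restrictᵖ ⟨$⟩ʳ r) <ᵇ (restrictᵖ ⟨$⟩ʳ t) ≡ (ψ ⟨$⟩ʳ nth S r) <ᵇ (ψ ⟨$⟩ʳ nth S t)
  restrictᵖ-<ᵇ r t = position-<ᵇ (∈image′⁺ ψ (nth∈ S r)) (∈image′⁺ ψ (nth∈ S t))

  embed-image′-restrictᵖ : ∀ A → embed T (image′ restrictᵖ A) ≡ image′ ψ (embed S A)
  embed-image′-restrictᵖ A = lookup-ext pointwise
    where
    pointwise : ∀ y → lookup (embed T (image′ restrictᵖ A)) y ≡ lookup (image′ ψ (embed S A)) y
    pointwise y with y ∈? T
    ... | yes y∈T = begin
      lookup (embed T (image′ restrictᵖ A)) y     ≡⟨ lookup-embed _ y∈T ⟩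
      lookup (image′ restrictᵖ A) (position y∈T)  ≡⟨ lookup-image′ restrictᵖ A _ ⟩
      lookup A (from (position y∈T))             ≡⟨ cong (lookup A) (position-cong ψ⁻¹-nth _ ψ⁻¹y∈S) ⟩
      lookup A (position ψ⁻¹y∈S)                 ≡⟨ sym (lookup-embed A ψ⁻¹y∈S) ⟩
      lookup (embed S A) (ψ ⟨$⟩ˡ y)               ≡⟨ sym (lookup-image′ ψ (embed S A) y) ⟩
      lookup (image′ ψ (embed S A)) y ∎
      where
      open ≡-Reasoning
      ψ⁻¹y∈S = ∈image′⁻ ψ {S} y∈T
      ψ⁻¹-nth = cong (ψ ⟨$⟩ˡ_) (nth-position y∈T)
    ... | no y∉T = trans (lookup-embed-∉ _ y∉T) (sym (trans (lookup-image′ ψ (embed S A) y)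
                     (lookup-embed-∉ {S = S} A λ ψ⁻¹y∈S → y∉T (subst (_∈ T) (inverseʳ ψ) (∈image′⁺ ψ ψ⁻¹y∈S)))))

  restrictᵖ-iso : ∀ {M M'} → IsIso′ ψ M M' → IsIso′ restrictᵖ (M ↾ S) (M' ↾ image′ ψ S)
  restrictᵖ-iso {M} {M'} ψ-iso A = trans (cong (indep M') (embed-image′-restrictᵖ A)) (ψ-iso (embed S A))

∏-nth : ∀ {n} (S : Subset n) (g : Fin n → Sign) →
        ∏ (λ r → g (nth S r)) ≡ ∏ (λ i → if lookup S i then g i else Sign.+)
∏-nth []          g = refl
∏-nth (true ∷ S)  g = cong (g zero *ˢ_) (∏-nth S (λ i → g (suc i)))
∏-nth (false ∷ S) g = ∏-nth S (λ i → g (suc i))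

∏-if : ∀ {n} c (g : Fin n → Sign) → ∏ (λ j → if c then g j else Sign.+) ≡ (if c then ∏ g else Sign.+)
∏-if         true  g = refl
∏-if {n = n} false g = ∏-+ n

<ᵇ-flip : ∀ {n} {i j : Fin n} → i ≢ j → j <ᵇ i ≡ not (i <ᵇ j)
<ᵇ-flip {i = i} {j} i≢j with Finₚ.<-cmp i j
... | tri< i<j _   _   =
  trans (dec-false (j Finₚ.<? i) (Finₚ.<-asym i<j)) (cong not (sym (dec-true (i Finₚ.<? j) i<j)))
... | tri≈ _   i≡j _   = contradiction i≡j i≢j
... | tri> _   _   j<i =
  trans (dec-true (j Finₚ.<? i) j<i) (cong not (sym (dec-false (i Finₚ.<? j) (Finₚ.<-asym j<i))))

onBlock : Bool → Bool → Sign → Sign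
onBlock p q s = if p then (if q then s else Sign.+) else Sign.+

∏∏ : ∀ {n} → (Fin n → Fin n → Sign) → Sign
∏∏ g = ∏ λ i → ∏ λ j → g i j

∏∏-cong : ∀ {n} {g h : Fin n → Fin n → Sign} → (∀ i j → g i j ≡ h i j) → ∏∏ g ≡ ∏∏ h
∏∏-cong g≗h = ∏-cong λ i → ∏-cong (g≗h i)

∏∏-distrib : ∀ {n} (g h : Fin n → Fin n → Sign) → ∏∏ (λ i j → g i j *ˢ h i j) ≡ ∏∏ g *ˢ ∏∏ h
∏∏-distrib g h = trans (∏-cong λ i → ∏-distrib (g i) (h i)) (∏-distrib (λ i → ∏ (g i)) (λ i → ∏ (h i)))

module _ {a b} (ψ : Permutation a b) where

  private
    I : Fin a → Fin a → Sign
    I i j = toSign (inverts ψ i j)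

  sgn′-restrictᵖ : ∀ S → sgn′ (restrictᵖ ψ S) ≡ ∏∏ λ i j → onBlock (lookup S i) (lookup S j) (I i j)
  sgn′-restrictᵖ S = begin
    sgn′ (restrictᵖ ψ S)
      ≡⟨ sgn′-∏ (restrictᵖ ψ S) ⟩
    ∏∏ (λ r t → toSign (inverts (restrictᵖ ψ S) r t))
      ≡⟨ ∏∏-cong (λ r t → cong toSign (cong₂ _∧_ (sym (nth-<ᵇ S r t)) (restrictᵖ-<ᵇ ψ S t r))) ⟩
    ∏∏ (λ r t → I (nth S r) (nth S t))
      ≡⟨ ∏-cong (λ r → ∏-nth S (I (nth S r))) ⟩
    ∏ (λ r → ∏ λ j → if lookup S j then I (nth S r) j else Sign.+)
      ≡⟨ ∏-nth S (λ i → ∏ λ j → if lookup S j then I i j else Sign.+) ⟩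
    ∏ (λ i → if lookup S i then ∏ (λ j → if lookup S j then I i j else Sign.+) else Sign.+)
      ≡⟨ ∏-cong (λ i → sym (∏-if (lookup S i) (λ j → if lookup S j then I i j else Sign.+))) ⟩
    ∏∏ (λ i j → onBlock (lookup S i) (lookup S j) (I i j)) ∎
    where open ≡-Reasoning

  crossingSign-image′ : ∀ C → crossingSign (image′ ψ C) ≡
    ∏∏ λ i j → toSign ((ψ ⟨$⟩ʳ i) <ᵇ (ψ ⟨$⟩ʳ j) ∧ not (lookup C i) ∧ lookup C j)
  crossingSign-image′ C = begin
    crossingSign ψC
      ≡⟨ crossingSign-∏ ψC ⟩
    ∏∏ (λ x y → toSign (x <ᵇ y ∧ not (lookup ψC x) ∧ lookup ψC y))
      ≡⟨ ∏-permute (λ x → ∏ λ y → toSign (x <ᵇ y ∧ not (lookup ψC x) ∧ lookup ψC y)) ψ ⟩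
    ∏ (λ i → ∏ λ y → toSign ((ψ ⟨$⟩ʳ i) <ᵇ y ∧ not (lookup ψC (ψ ⟨$⟩ʳ i)) ∧ lookup ψC y))
      ≡⟨ ∏-cong (λ i → ∏-permute (λ y → toSign ((ψ ⟨$⟩ʳ i) <ᵇ y ∧ not (lookup ψC (ψ ⟨$⟩ʳ i)) ∧ lookup ψC y)) ψ) ⟩
    ∏∏ (λ i j → toSign ((ψ ⟨$⟩ʳ i) <ᵇ (ψ ⟨$⟩ʳ j) ∧ not (lookup ψC (ψ ⟨$⟩ʳ i)) ∧ lookup ψC (ψ ⟨$⟩ʳ j)))
      ≡⟨ ∏∏-cong (λ i j → cong₂ (λ u v → toSign ((ψ ⟨$⟩ʳ i) <ᵇ (ψ ⟨$⟩ʳ j) ∧ not u ∧ v)) (lookup-ψC i) (lookup-ψC j)) ⟩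
    ∏∏ (λ i j → toSign ((ψ ⟨$⟩ʳ i) <ᵇ (ψ ⟨$⟩ʳ j) ∧ not (lookup C i) ∧ lookup C j)) ∎
    where
    open ≡-Reasoning
    ψC = image′ ψ C
    lookup-ψC : ∀ i → lookup ψC (ψ ⟨$⟩ʳ i) ≡ lookup C i
    lookup-ψC i = trans (lookup-image′ ψ C _) (cong (lookup C) (inverseˡ ψ))

  -- A pair i ∉ C, j ∈ C is counted by crossingSign C iff i < j, by crossingSign (image′ ψ C)
  -- iff ψ i < ψ j, and it is an inversion of ψ iff exactly one of these holds.
  crossing-pair : ∀ C i j →
    (onBlock (not (lookup C i)) (lookup C j) (I i j) *ˢ onBlock (lookup C j) (not (lookup C i)) (I j i))
      *ˢ toSign (i <ᵇ j ∧ not (lookup C i) ∧ lookup C j)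
    ≡ toSign ((ψ ⟨$⟩ʳ i) <ᵇ (ψ ⟨$⟩ʳ j) ∧ not (lookup C i) ∧ lookup C j)
  crossing-pair C i j with lookup C i in i∈? | lookup C j in j∈?
  ... | true  | true  = cong toSign (trans (∧-zeroʳ (i <ᵇ j)) (sym (∧-zeroʳ _)))
  ... | true  | false = cong toSign (trans (∧-zeroʳ (i <ᵇ j)) (sym (∧-zeroʳ _)))
  ... | false | false = cong toSign (trans (∧-zeroʳ (i <ᵇ j)) (sym (∧-zeroʳ _)))
  ... | false | true  = begin
    (toSign (i <ᵇ j ∧ ψj <ᵇ ψi) *ˢ toSign (j <ᵇ i ∧ ψi <ᵇ ψj)) *ˢ toSign (i <ᵇ j ∧ true)
      ≡⟨ cong (λ s → (toSign (i <ᵇ j ∧ ψj <ᵇ ψi) *ˢ s) *ˢ toSign (i <ᵇ j ∧ true))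
              (cong toSign (cong₂ _∧_ (<ᵇ-flip i≢j) (<ᵇ-flip ψj≢ψi))) ⟩
    (toSign (i <ᵇ j ∧ ψj <ᵇ ψi) *ˢ toSign (not (i <ᵇ j) ∧ not (ψj <ᵇ ψi))) *ˢ toSign (i <ᵇ j ∧ true)
      ≡⟨ parity (i <ᵇ j) (ψj <ᵇ ψi) ⟩
    toSign (not (ψj <ᵇ ψi) ∧ true)
      ≡⟨ cong (λ b → toSign (b ∧ true)) (sym (<ᵇ-flip ψj≢ψi)) ⟩
    toSign (ψi <ᵇ ψj ∧ true) ∎
    where
    open ≡-Reasoning
    ψi = ψ ⟨$⟩ʳ i
    ψj = ψ ⟨$⟩ʳ j
    i≢j : i ≢ j
    i≢j i≡j with trans (sym i∈?) (trans (cong (lookup C) i≡j) j∈?)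
    ... | ()
    ψj≢ψi : ψj ≢ ψi
    ψj≢ψi ψj≡ψi = i≢j (sym (trans (sym (inverseˡ ψ)) (trans (cong (ψ ⟨$⟩ˡ_) ψj≡ψi) (inverseˡ ψ))))
    parity : ∀ p q → (toSign (p ∧ q) *ˢ toSign (not p ∧ not q)) *ˢ toSign (p ∧ true) ≡ toSign (not q ∧ true)
    parity true  true  = refl
    parity true  false = refl
    parity false true  = refl
    parity false false = refl

  -- Split the pairs (i , j) of sgn′-∏ by membership of i and j in C: pairs inside C or inside ∁ C
  -- give the signs of the restrictions, and the mixed pairs turn crossingSign C into
  -- crossingSign (image′ ψ C) by crossing-pair.
  sgn′-split : ∀ C → sgn′ ψ *ˢ crossingSign C ≡
    (sgn′ (restrictᵖ ψ C) *ˢ sgn′ (restrictᵖ ψ (∁ C))) *ˢ crossingSign (image′ ψ C)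
  sgn′-split C = begin
    sgn′ ψ *ˢ crossingSign C
      ≡⟨ cong (_*ˢ crossingSign C) (trans (sgn′-∏ ψ) (∏∏-cong λ i j → into-blocks (c i) (c j) (I i j))) ⟩
    ∏∏ (λ i j → B₁ i j *ˢ (B₂ i j *ˢ (B₃ i j *ˢ B₄ i j))) *ˢ crossingSign C
      ≡⟨ cong (_*ˢ crossingSign C) (trans (∏∏-distrib B₁ _) (cong (∏∏ B₁ *ˢ_)
           (trans (∏∏-distrib B₂ _) (cong (∏∏ B₂ *ˢ_) (∏∏-distrib B₃ B₄))))) ⟩
    (∏∏ B₁ *ˢ (∏∏ B₂ *ˢ (∏∏ B₃ *ˢ ∏∏ B₄))) *ˢ crossingSign C
      ≡⟨ trans (cong (_*ˢ crossingSign C) (sym (Signₚ.*-assoc (∏∏ B₁) _ _))) (Signₚ.*-assoc (∏∏ B₁ *ˢ ∏∏ B₂) _ _) ⟩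
    (∏∏ B₁ *ˢ ∏∏ B₂) *ˢ ((∏∏ B₃ *ˢ ∏∏ B₄) *ˢ crossingSign C)
      ≡⟨ cong₂ _*ˢ_ (cong₂ _*ˢ_ (sym (sgn′-restrictᵖ C)) (sym ∏∏B₂)) mixed-blocks ⟩
    (sgn′ (restrictᵖ ψ C) *ˢ sgn′ (restrictᵖ ψ (∁ C))) *ˢ crossingSign (image′ ψ C) ∎
    where
    open ≡-Reasoning
    c : Fin a → Bool
    c = lookup C
    B₁ B₂ B₃ B₄ : Fin a → Fin a → Sign
    B₁ i j = onBlock (c i) (c j) (I i j)
    B₂ i j = onBlock (not (c i)) (not (c j)) (I i j)
    B₃ i j = onBlock (not (c i)) (c j) (I i j)
    B₄ i j = onBlock (c i) (not (c j)) (I i j)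
    into-blocks : ∀ p q s →
      s ≡ onBlock p q s *ˢ (onBlock (not p) (not q) s *ˢ (onBlock (not p) q s *ˢ onBlock p (not q) s))
    into-blocks true  true  s = sym (Signₚ.*-identityʳ s)
    into-blocks true  false s = refl
    into-blocks false true  s = sym (Signₚ.*-identityʳ s)
    into-blocks false false s = sym (Signₚ.*-identityʳ s)
    ∏∏B₂ : sgn′ (restrictᵖ ψ (∁ C)) ≡ ∏∏ B₂
    ∏∏B₂ = trans (sgn′-restrictᵖ (∁ C)) (∏∏-cong λ i j →
      cong₂ (λ p q → onBlock p q (I i j)) (lookup-map i not C) (lookup-map j not C))
    mixed-blocks : (∏∏ B₃ *ˢ ∏∏ B₄) *ˢ crossingSign C ≡ crossingSign (image′ ψ C)
    mixed-blocks = begin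
      (∏∏ B₃ *ˢ ∏∏ B₄) *ˢ crossingSign C
        ≡⟨ cong₂ _*ˢ_ (cong (∏∏ B₃ *ˢ_) (∏-comm B₄)) (crossingSign-∏ C) ⟩
      (∏∏ B₃ *ˢ ∏∏ (λ i j → B₄ j i)) *ˢ ∏∏ X
        ≡⟨ cong (_*ˢ ∏∏ X) (sym (∏∏-distrib B₃ (λ i j → B₄ j i))) ⟩
      ∏∏ (λ i j → B₃ i j *ˢ B₄ j i) *ˢ ∏∏ X
        ≡⟨ sym (∏∏-distrib (λ i j → B₃ i j *ˢ B₄ j i) X) ⟩
      ∏∏ (λ i j → (B₃ i j *ˢ B₄ j i) *ˢ X i j)
        ≡⟨ ∏∏-cong (crossing-pair C) ⟩
      ∏∏ (λ i j → toSign ((ψ ⟨$⟩ʳ i) <ᵇ (ψ ⟨$⟩ʳ j) ∧ not (c i) ∧ c j))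
        ≡⟨ sym (crossingSign-image′ C) ⟩
      crossingSign (image′ ψ C) ∎
      where
      X : Fin a → Fin a → Sign
      X i j = toSign (i <ᵇ j ∧ not (c i) ∧ c j)

-- Shuffles

↑ˡ-<ᵇ : ∀ {k} m (r t : Fin k) → (r ↑ˡ m) <ᵇ (t ↑ˡ m) ≡ r <ᵇ t
↑ˡ-<ᵇ m zero    zero    = refl
↑ˡ-<ᵇ m zero    (suc t) = refl
↑ˡ-<ᵇ m (suc r) zero    = refl
↑ˡ-<ᵇ m (suc r) (suc t) = ↑ˡ-<ᵇ m r t

↑ʳ-<ᵇ : ∀ k {m} (r t : Fin m) → (k ↑ʳ r) <ᵇ (k ↑ʳ t) ≡ r <ᵇ t
↑ʳ-<ᵇ zero    r t = refl
↑ʳ-<ᵇ (suc k) r t = ↑ʳ-<ᵇ k r t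

↑ˡ<ᵇ↑ʳ : ∀ {k} m (r : Fin k) (t : Fin m) → (r ↑ˡ m) <ᵇ (k ↑ʳ t) ≡ true
↑ˡ<ᵇ↑ʳ m zero    t = refl
↑ˡ<ᵇ↑ʳ m (suc r) t = ↑ˡ<ᵇ↑ʳ m r t

↑ʳ<ᵇ↑ˡ : ∀ {k} m (r : Fin k) (t : Fin m) → (k ↑ʳ t) <ᵇ (r ↑ˡ m) ≡ false
↑ʳ<ᵇ↑ˡ m zero    t = refl
↑ʳ<ᵇ↑ˡ m (suc r) t = ↑ʳ<ᵇ↑ˡ m r t

lookup-take : ∀ {A : Set} k {m} (xs : Vec A (k + m)) r → lookup (take k xs) r ≡ lookup xs (r ↑ˡ m)
lookup-take (suc k) (x ∷ xs) zero    = refl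
lookup-take (suc k) (x ∷ xs) (suc r) = lookup-take k xs r

lookup-drop : ∀ {A : Set} k {m} (xs : Vec A (k + m)) r → lookup (drop k xs) r ≡ lookup xs (k ↑ʳ r)
lookup-drop zero    xs       r = refl
lookup-drop (suc k) (x ∷ xs) r = lookup-drop k xs r

module _ {n} (C : Subset n) where

  private
    k = ∣ C ∣
    m = ∣ ∁ C ∣

    to : Fin n → Fin (k + m)
    to x with x ∈? C
    ... | yes x∈C = position x∈C ↑ˡ m
    ... | no  x∉C = k ↑ʳ position (x∉p⇒x∈∁p x∉C)

    from : Fin (k + m) → Fin n
    from = [ nth C , nth (∁ C) ]′ ∘ splitAt k

    from-to : ∀ x → from (to x) ≡ x
    from-to x with x ∈? C
    ... | yes x∈C rewrite Finₚ.splitAt-↑ˡ k (position x∈C) m = nth-position x∈C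
    ... | no  x∉C rewrite Finₚ.splitAt-↑ʳ k m (position (x∉p⇒x∈∁p x∉C)) = nth-position _

    to-from : ∀ y → to (from y) ≡ y
    to-from y with splitAt k y in eq
    ... | inj₁ r with nth C r ∈? C
    ...   | yes p = trans (cong (_↑ˡ m) (position-nth C r p)) (Finₚ.splitAt⁻¹-↑ˡ eq)
    ...   | no  q = contradiction (nth∈ C r) q
    to-from y | inj₂ r with nth (∁ C) r ∈? C
    ...   | yes p = contradiction p (x∈∁p⇒x∉p (nth∈ (∁ C) r))
    ...   | no  q = trans (cong (k ↑ʳ_) (position-nth (∁ C) r _)) (Finₚ.splitAt⁻¹-↑ʳ eq)

  -- Lists the elements of C first and then those of ∁ C, both in increasing order.
  shuffle : Permutation n (∣ C ∣ + ∣ ∁ C ∣)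
  shuffle = permutation to from to-from from-to

  sgn′-shuffle : sgn′ shuffle ≡ crossingSign C
  sgn′-shuffle = trans (sgn′-∏ shuffle) (trans (∏-cong λ i → ∏-cong λ j → cong toSign (inverts-shuffle i j))
                                               (sym (crossingSign-∏ C)))
    where
    inverts-shuffle : ∀ i j → inverts shuffle i j ≡ (i <ᵇ j ∧ not (lookup C i) ∧ lookup C j)
    inverts-shuffle i j with i ∈? C | j ∈? C
    ... | yes i∈C | yes j∈C = begin
      i <ᵇ j ∧ (position j∈C ↑ˡ m) <ᵇ (position i∈C ↑ˡ m)
        ≡⟨ cong (i <ᵇ j ∧_) (trans (↑ˡ-<ᵇ m (position j∈C) (position i∈C)) (position-<ᵇ j∈C i∈C)) ⟩
      i <ᵇ j ∧ j <ᵇ i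
        ≡⟨ trans (<ᵇ-asym i j) (sym (∧-zeroʳ (i <ᵇ j))) ⟩
      i <ᵇ j ∧ not true ∧ true
        ≡⟨ cong₂ (λ u v → i <ᵇ j ∧ not u ∧ v) (sym ([]=⇒lookup i∈C)) (sym ([]=⇒lookup j∈C)) ⟩
      i <ᵇ j ∧ not (lookup C i) ∧ lookup C j ∎
      where open ≡-Reasoning
    ... | yes i∈C | no j∉C = begin
      i <ᵇ j ∧ (k ↑ʳ position (x∉p⇒x∈∁p j∉C)) <ᵇ (position i∈C ↑ˡ m)
        ≡⟨ cong (i <ᵇ j ∧_) (↑ʳ<ᵇ↑ˡ m (position i∈C) (position (x∉p⇒x∈∁p j∉C))) ⟩
      i <ᵇ j ∧ false
        ≡⟨ cong₂ (λ u v → i <ᵇ j ∧ not u ∧ v) (sym ([]=⇒lookup i∈C)) (sym (∉⇒lookup≡false j∉C)) ⟩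
      i <ᵇ j ∧ not (lookup C i) ∧ lookup C j ∎
      where open ≡-Reasoning
    ... | no i∉C | yes j∈C = begin
      i <ᵇ j ∧ (position j∈C ↑ˡ m) <ᵇ (k ↑ʳ position (x∉p⇒x∈∁p i∉C))
        ≡⟨ cong (i <ᵇ j ∧_) (↑ˡ<ᵇ↑ʳ m (position j∈C) (position (x∉p⇒x∈∁p i∉C))) ⟩
      i <ᵇ j ∧ true
        ≡⟨ cong₂ (λ u v → i <ᵇ j ∧ not u ∧ v) (sym (∉⇒lookup≡false i∉C)) (sym ([]=⇒lookup j∈C)) ⟩
      i <ᵇ j ∧ not (lookup C i) ∧ lookup C j ∎
      where open ≡-Reasoning
    ... | no i∉C | no j∉C = begin
      i <ᵇ j ∧ (k ↑ʳ position j∈∁C) <ᵇ (k ↑ʳ position i∈∁C)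
        ≡⟨ cong (i <ᵇ j ∧_) (trans (↑ʳ-<ᵇ k (position j∈∁C) (position i∈∁C)) (position-<ᵇ j∈∁C i∈∁C)) ⟩
      i <ᵇ j ∧ j <ᵇ i
        ≡⟨ trans (<ᵇ-asym i j) (sym (∧-zeroʳ (i <ᵇ j))) ⟩
      i <ᵇ j ∧ not false ∧ false
        ≡⟨ cong₂ (λ u v → i <ᵇ j ∧ not u ∧ v) (sym (∉⇒lookup≡false i∉C)) (sym (∉⇒lookup≡false j∉C)) ⟩
      i <ᵇ j ∧ not (lookup C i) ∧ lookup C j ∎
      where
      open ≡-Reasoning
      i∈∁C = x∉p⇒x∈∁p i∉C
      j∈∁C = x∉p⇒x∈∁p j∉C

  shuffle-directSum : ∀ {M : Matroid n} → Separator M C → IsDirectSum (M ↾ C) (M ↾ ∁ C) (permuteᴹ shuffle M)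
  shuffle-directSum {M} sepC S =
    trans (sepC X) (cong₂ _∧_ (cong (indep M) (lookup-ext X∩C)) (cong (indep M) (lookup-ext X∩∁C)))
    where
    X = image′ (flip shuffle) S
    X∩C : ∀ x → lookup (X ∩ C) x ≡ lookup (embed C (take k S)) x
    X∩C x = trans (lookup-zipWith _∧_ x X C) (trans (cong (_∧ lookup C x) (lookup-image′ (flip shuffle) S x)) (at x))
      where
      at : ∀ x → lookup S (to x) ∧ lookup C x ≡ lookup (embed C (take k S)) x
      at x with x ∈? C
      ... | yes x∈C = trans (cong (lookup S (position x∈C ↑ˡ m) ∧_) ([]=⇒lookup x∈C))
                      (trans (∧-identityʳ _) (sym (trans (lookup-embed (take k S) x∈C) (lookup-take k S _))))
      ... | no  x∉C = trans (cong (lookup S (k ↑ʳ position (x∉p⇒x∈∁p x∉C)) ∧_) (∉⇒lookup≡false x∉C))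
                      (trans (∧-zeroʳ _) (sym (lookup-embed-∉ _ x∉C)))
    X∩∁C : ∀ x → lookup (X ∩ ∁ C) x ≡ lookup (embed (∁ C) (drop k S)) x
    X∩∁C x = trans (lookup-zipWith _∧_ x X (∁ C))
      (trans (cong₂ _∧_ (lookup-image′ (flip shuffle) S x) (lookup-map x not C)) (at x))
      where
      at : ∀ x → lookup S (to x) ∧ not (lookup C x) ≡ lookup (embed (∁ C) (drop k S)) x
      at x with x ∈? C
      ... | yes x∈C = trans (cong (λ b → lookup S (position x∈C ↑ˡ m) ∧ not b) ([]=⇒lookup x∈C))
                      (trans (∧-zeroʳ _) (sym (lookup-embed-∉ _ (x∈p⇒x∉∁p x∈C))))
      ... | no  x∉C = trans (cong (λ b → lookup S (k ↑ʳ position (x∉p⇒x∈∁p x∉C)) ∧ not b) (∉⇒lookup≡false x∉C))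
                      (trans (∧-identityʳ _) (sym (trans (lookup-embed (drop k S) (x∉p⇒x∈∁p x∉C)) (lookup-drop k S _))))

infix 4 _≅_
record _≅_ {a b} (M : Matroid a) (N : Matroid b) : Set where
  field
    size       : a ≡ b
    indep-cast : ∀ A → indep N (cast size A) ≡ indep M A

≅-refl : ∀ {n} {M : Matroid n} → M ≅ M
≅-refl {M = M} = record { size = refl ; indep-cast = λ A → cong (indep M) (cast-is-id refl A) }

↾-cong : ∀ {n} (M : Matroid n) {X Y} → X ≡ Y → M ↾ X ≅ M ↾ Y
↾-cong M refl = ≅-refl

embed-embed-trace : ∀ {n} (T X : Subset n) A .(e : ∣ trace T X ∣ ≡ ∣ X ∩ T ∣) →
                    embed T (embed (trace T X) A) ≡ embed (X ∩ T) (cast e A)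
embed-embed-trace []          []          []      e = refl
embed-embed-trace (true ∷ T)  (true ∷ X)  (a ∷ A) e = cong (a ∷_) (embed-embed-trace T X A (cong pred e))
embed-embed-trace (true ∷ T)  (false ∷ X) A       e = cong (false ∷_) (embed-embed-trace T X A e)
embed-embed-trace (false ∷ T) (true ∷ X)  A       e = cong (false ∷_) (embed-embed-trace T X A e)
embed-embed-trace (false ∷ T) (false ∷ X) A       e = cong (false ∷_) (embed-embed-trace T X A e)

↾-↾-trace : ∀ {n} (M : Matroid n) T X → (M ↾ T) ↾ trace T X ≅ M ↾ (X ∩ T)
↾-↾-trace M T X = record
  { size       = ∣trace∣≡∣∩∣ T X
  ; indep-cast = λ A → cong (indep M) (sym (embed-embed-trace T X A _))
  }

≅-trans : ∀ {a b c} {M : Matroid a} {N : Matroid b} {P : Matroid c} → M ≅ N → N ≅ P → M ≅ P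
≅-trans {M = M} {N} {P} M≅N N≅P = record
  { size       = trans (M≅N .size) (N≅P .size)
  ; indep-cast = λ A → begin
      indep P (cast (trans (M≅N .size) (N≅P .size)) A)
        ≡⟨ cong (indep P) (sym (cast-trans (M≅N .size) (N≅P .size) A)) ⟩
      indep P (cast (N≅P .size) (cast (M≅N .size) A))
        ≡⟨ N≅P .indep-cast _ ⟩
      indep N (cast (M≅N .size) A)
        ≡⟨ M≅N .indep-cast A ⟩
      indep M A ∎
  }
  where
  open _≅_
  open ≡-Reasoning

↾-↾-∁trace : ∀ {n} (M : Matroid n) T X → (M ↾ T) ↾ ∁ (trace T X) ≅ M ↾ (∁ X ∩ T)
↾-↾-∁trace M T X = ≅-trans (↾-cong (M ↾ T) (sym (trace-∁ T X))) (↾-↾-trace M T (∁ X))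

embed-⊤ˡ : ∀ {n} A .(e : ∣ ⊤ {n} ∣ ≡ n) → embed ⊤ A ≡ cast e A
embed-⊤ˡ {zero}  []      e = refl
embed-⊤ˡ {suc n} (a ∷ A) e = cong (a ∷_) (embed-⊤ˡ A (cong pred e))

↾⊤ : ∀ {n} (M : Matroid n) → M ↾ ⊤ ≅ M
↾⊤ {n} M = record { size = ∣⊤∣≡n n ; indep-cast = λ A → cong (indep M) (sym (embed-⊤ˡ A _)) }

≗⇒≅ : ∀ {n} {M N : Matroid n} → (∀ A → indep M A ≡ indep N A) → M ≅ N
≗⇒≅ {N = N} M≗N = record
  { size = refl ; indep-cast = λ A → trans (cong (indep N) (cast-is-id refl A)) (sym (M≗N A)) }

-- Direct sums

leftPart : ∀ n m → Subset (n + m)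
leftPart n m = ⊤ {n} ++ ⊥ {m}

embed-⊥ˡ : ∀ {m} (A : Subset ∣ ⊥ {m} ∣) → embed (⊥ {m}) A ≡ ⊥
embed-⊥ˡ {zero}  []  = refl
embed-⊥ˡ {suc m} A   = cong (false ∷_) (embed-⊥ˡ {m} A)

embed-∁⊥ˡ : ∀ {m} A .(e : ∣ ∁ (⊥ {m}) ∣ ≡ m) → embed (∁ ⊥) A ≡ cast e A
embed-∁⊥ˡ {zero}  []      e = refl
embed-∁⊥ˡ {suc m} (a ∷ A) e = cong (a ∷_) (embed-∁⊥ˡ A (cong pred e))

module _ {m : ℕ} where

  take-∩leftPart : ∀ n (I : Subset (n + m)) → take n (I ∩ leftPart n m) ≡ take n I
  take-∩leftPart zero    I       = refl
  take-∩leftPart (suc n) (i ∷ I) = cong₂ _∷_ (∧-identityʳ i) (take-∩leftPart n I)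

  drop-∩leftPart : ∀ n (I : Subset (n + m)) → drop n (I ∩ leftPart n m) ≡ ⊥
  drop-∩leftPart zero    I       = ∩-zeroʳ I
  drop-∩leftPart (suc n) (i ∷ I) = drop-∩leftPart n I

  take-∩∁leftPart : ∀ n (I : Subset (n + m)) → take n (I ∩ ∁ (leftPart n m)) ≡ ⊥
  take-∩∁leftPart zero    I       = refl
  take-∩∁leftPart (suc n) (i ∷ I) = cong₂ _∷_ (∧-zeroʳ i) (take-∩∁leftPart n I)

  drop-∩∁leftPart : ∀ n (I : Subset (n + m)) → drop n (I ∩ ∁ (leftPart n m)) ≡ drop n I
  drop-∩∁leftPart zero    I       = trans (cong (I ∩_) (∁⊥ {m})) (∩-identityʳ I)
  drop-∩∁leftPart (suc n) (i ∷ I) = drop-∩∁leftPart n I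

  take-embed-leftPart : ∀ n A .(e : ∣ leftPart n m ∣ ≡ n) → take n (embed (leftPart n m) A) ≡ cast e A
  take-embed-leftPart zero    A       e = Vec₀-unique _ _
    where
    Vec₀-unique : (u v : Subset 0) → u ≡ v
    Vec₀-unique [] [] = refl
  take-embed-leftPart (suc n) (a ∷ A) e = cong (a ∷_) (take-embed-leftPart n A (cong pred e))

  drop-embed-leftPart : ∀ n A → drop n (embed (leftPart n m) A) ≡ ⊥
  drop-embed-leftPart zero    A       = embed-⊥ˡ {m} A
  drop-embed-leftPart (suc n) (a ∷ A) = drop-embed-leftPart n A

  take-embed-∁leftPart : ∀ n A → take n (embed (∁ (leftPart n m)) A) ≡ ⊥
  take-embed-∁leftPart zero    A = refl
  take-embed-∁leftPart (suc n) A = cong (false ∷_) (take-embed-∁leftPart n A)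

  drop-embed-∁leftPart : ∀ n A .(e : ∣ ∁ (leftPart n m) ∣ ≡ m) → drop n (embed (∁ (leftPart n m)) A) ≡ cast e A
  drop-embed-∁leftPart zero    A e = embed-∁⊥ˡ {m} A e
  drop-embed-∁leftPart (suc n) A e = drop-embed-∁leftPart n A e

  ∣leftPart∣ : ∀ n → ∣ leftPart n m ∣ ≡ n
  ∣leftPart∣ zero    = ∣⊥∣≡0 m
  ∣leftPart∣ (suc n) = cong suc (∣leftPart∣ n)

  ∣∁leftPart∣ : ∀ n → ∣ ∁ (leftPart n m) ∣ ≡ m
  ∣∁leftPart∣ zero    = trans (cong ∣_∣ (∁⊥ {m})) (∣⊤∣≡n m)
  ∣∁leftPart∣ (suc n) = ∣∁leftPart∣ n

  crossingSign-leftPart : ∀ n → crossingSign (leftPart n m) ≡ Sign.+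
  crossingSign-leftPart zero    = crossingSign-⊥ m
    where
    crossingSign-⊥ : ∀ m → crossingSign (⊥ {m}) ≡ Sign.+
    crossingSign-⊥ zero    = refl
    crossingSign-⊥ (suc m) =
      trans (cong (λ k → paritySign k *ˢ crossingSign (⊥ {m})) (∣⊥∣≡0 m)) (crossingSign-⊥ m)
  crossingSign-leftPart (suc n) = crossingSign-leftPart n

module _ {n m} (M : Matroid n) (Q : Matroid m) (R : Matroid (n + m)) (R≡M⊕Q : IsDirectSum M Q R) where
  open ≡-Reasoning

  private
    indep-≡⊥ : ∀ {k} (N : Matroid k) {A} → A ≡ ⊥ → indep N A ≡ true
    indep-≡⊥ N refl = indep-∅ N

  Separator-leftPart : Separator R (leftPart n m)
  Separator-leftPart I = sym (begin
    indep R (I ∩ L) ∧ indep R (I ∩ ∁ L)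
      ≡⟨ cong₂ _∧_ (R≡M⊕Q (I ∩ L)) (R≡M⊕Q (I ∩ ∁ L)) ⟩
    (indep M (take n (I ∩ L)) ∧ indep Q (drop n (I ∩ L))) ∧
    (indep M (take n (I ∩ ∁ L)) ∧ indep Q (drop n (I ∩ ∁ L)))
      ≡⟨ cong₂ _∧_ (cong₂ _∧_ (cong (indep M) (take-∩leftPart n I)) (indep-≡⊥ Q (drop-∩leftPart n I)))
                   (cong₂ _∧_ (indep-≡⊥ M (take-∩∁leftPart n I)) (cong (indep Q) (drop-∩∁leftPart n I))) ⟩
    (indep M (take n I) ∧ true) ∧ indep Q (drop n I)
      ≡⟨ cong (_∧ indep Q (drop n I)) (∧-identityʳ _) ⟩
    indep M (take n I) ∧ indep Q (drop n I)
      ≡⟨ sym (R≡M⊕Q I) ⟩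
    indep R I ∎)
    where L = leftPart n m

  ↾leftPart : R ↾ leftPart n m ≅ M
  ↾leftPart = record
    { size       = ∣leftPart∣ n
    ; indep-cast = λ A → sym (begin
        indep R (embed L A)
          ≡⟨ R≡M⊕Q _ ⟩
        indep M (take n (embed L A)) ∧ indep Q (drop n (embed L A))
          ≡⟨ cong₂ _∧_ (cong (indep M) (take-embed-leftPart n A _)) (indep-≡⊥ Q (drop-embed-leftPart n A)) ⟩
        indep M (cast _ A) ∧ true
          ≡⟨ ∧-identityʳ _ ⟩
        indep M (cast _ A) ∎)
    }
    where L = leftPart n m

  ↾∁leftPart : R ↾ ∁ (leftPart n m) ≅ Q
  ↾∁leftPart = record
    { size       = ∣∁leftPart∣ n
    ; indep-cast = λ A → sym (begin
        indep R (embed ∁L A)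
          ≡⟨ R≡M⊕Q _ ⟩
        indep M (take n (embed ∁L A)) ∧ indep Q (drop n (embed ∁L A))
          ≡⟨ cong₂ _∧_ (indep-≡⊥ M (take-embed-∁leftPart n A)) (cong (indep Q) (drop-embed-∁leftPart n A _)) ⟩
        indep Q (cast _ A) ∎)
    }
    where ∁L = ∁ (leftPart n m)

signℚ : Sign → ℚ
signℚ Sign.+ = 1ℚ
signℚ Sign.- = - 1ℚ

signℚ-* : ∀ s t → signℚ (s *ˢ t) ≡ signℚ s *ℚ signℚ t
signℚ-* Sign.- Sign.- = refl
signℚ-* Sign.- Sign.+ = refl
signℚ-* Sign.+ Sign.- = refl
signℚ-* Sign.+ Sign.+ = refl

signℚ-opposite : ∀ s → signℚ (opposite s) ≡ (- 1ℚ) *ℚ signℚ s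
signℚ-opposite Sign.- = refl
signℚ-opposite Sign.+ = refl

sgnℚ≡signℚ∘paritySign : ∀ k → sgnℚ k ≡ signℚ (paritySign k)
sgnℚ≡signℚ∘paritySign zero    = refl
sgnℚ≡signℚ∘paritySign (suc k) = trans (cong -_ (sgnℚ≡signℚ∘paritySign k)) (-signℚ (paritySign k))
  where
  -signℚ : ∀ s → - signℚ s ≡ signℚ (opposite s)
  -signℚ Sign.- = refl
  -signℚ Sign.+ = refl

module GradedCommAlgProperties (A : GradedCommAlg) where

  open GradedCommAlg A
  module Modₙ (n : ℕ) = Module (Mod n)

  ≈-refl : ∀ {n} {x : Car n} → x ≈ x
  ≈-refl {n} = Modₙ.≈ᴹ-refl n

  ≈-sym : ∀ {n} {x y : Car n} → x ≈ y → y ≈ x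
  ≈-sym {n} = Modₙ.≈ᴹ-sym n

  ≈-trans : ∀ {n} {x y z : Car n} → x ≈ y → y ≈ z → x ≈ z
  ≈-trans {n} = Modₙ.≈ᴹ-trans n

  ≈-reflexive : ∀ {n} {x y : Car n} → x ≡ y → x ≈ y
  ≈-reflexive refl = ≈-refl

  module ≈-Reasoning {n : ℕ} = SetoidReasoning (Modₙ.≈ᴹ-setoid n)

  infixr 25 _⊙_
  _⊙_ : ∀ {n} → Sign → Car n → Car n
  s ⊙ x = signℚ s *ᴬ x

  ⊙-cong : ∀ {n} s {x y : Car n} → x ≈ y → (s ⊙ x) ≈ (s ⊙ y)
  ⊙-cong {n} s = Modₙ.*ₗ-cong n refl

  ⊙-assoc : ∀ {n} s t (x : Car n) → (s ⊙ t ⊙ x) ≈ ((s *ˢ t) ⊙ x)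
  ⊙-assoc {n} s t x = ≈-sym (≈-trans (Modₙ.*ₗ-cong n (signℚ-* s t) ≈-refl) (Modₙ.*ₗ-assoc n (signℚ s) (signℚ t) x))

  ⊙-identity : ∀ {n} (x : Car n) → (Sign.+ ⊙ x) ≈ x
  ⊙-identity {n} = Modₙ.*ₗ-identityˡ n

  ⊙-·ˡ : ∀ {n m} s (x : Car n) (y : Car m) → ((s ⊙ x) · y) ≈ (s ⊙ (x · y))
  ⊙-·ˡ s = ·-scalˡ (signℚ s)

  ⊙-·ʳ : ∀ {n m} s (x : Car n) (y : Car m) → (x · (s ⊙ y)) ≈ (s ⊙ (x · y))
  ⊙-·ʳ s = ·-scalʳ (signℚ s)

  infix 4 _≋_
  _≋_ : ∀ {n m} → Car n → Car m → Set
  _≋_ {n} {m} x y = Σ (n ≡ m) λ n≡m → subst Car n≡m x ≈ y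

  ≈⇒≋ : ∀ {n} {x y : Car n} → x ≈ y → x ≋ y
  ≈⇒≋ x≈y = refl , x≈y

  ≋⇒≈ : ∀ {n} {x y : Car n} → x ≋ y → x ≈ y
  ≋⇒≈ {x = x} (n≡n , x≈y) = subst (λ e → subst Car e x ≈ _) (ℕₚ.≡-irrelevant n≡n refl) x≈y

  ≋-refl : ∀ {n} {x : Car n} → x ≋ x
  ≋-refl = refl , ≈-refl

  ≋-sym : ∀ {n m} {x : Car n} {y : Car m} → x ≋ y → y ≋ x
  ≋-sym (refl , x≈y) = refl , ≈-sym x≈y

  ≋-trans : ∀ {n m k} {x : Car n} {y : Car m} {z : Car k} → x ≋ y → y ≋ z → x ≋ z
  ≋-trans (refl , x≈y) (refl , y≈z) = refl , ≈-trans x≈y y≈z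

  subst-≋ : ∀ {n m} (n≡m : n ≡ m) (x : Car n) → subst Car n≡m x ≋ x
  subst-≋ refl x = ≋-refl

  ·-≋-cong : ∀ {a a' b b'} {x : Car a} {x' : Car a'} {y : Car b} {y' : Car b'} →
             x ≋ x' → y ≋ y' → x · y ≋ x' · y'
  ·-≋-cong (refl , x≈x') (refl , y≈y') = refl , ·-cong x≈x' y≈y'

  ⊙-≋-cong : ∀ {n m} s {x : Car n} {y : Car m} → x ≋ y → s ⊙ x ≋ s ⊙ y
  ⊙-≋-cong s (refl , x≈y) = refl , ⊙-cong s x≈y

  ·-assoc≋ : ∀ {n m k} (x : Car n) (y : Car m) (z : Car k) → (x · y) · z ≋ x · (y · z)
  ·-assoc≋ {n} {m} {k} x y z = ≋-trans (≈⇒≋ (·-assoc x y z)) (subst-≋ (sym (ℕₚ.+-assoc n m k)) _)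

  ·-identityʳ≋ : ∀ {n} (x : Car n) → x · one ≋ x
  ·-identityʳ≋ {n} x = ≋-trans (≈⇒≋ (·-idʳ x)) (subst-≋ (sym (ℕₚ.+-identityʳ n)) x)

  ·-comm≋ : ∀ {n m} (x : Car n) (y : Car m) → x · y ≋ paritySign (n * m) ⊙ (y · x)
  ·-comm≋ {n} {m} x y = ≋-trans (≈⇒≋ (·-gcomm x y))
    (≋-trans (≈⇒≋ (Modₙ.*ₗ-cong (n + m) (sgnℚ≡signℚ∘paritySign (n * m)) ≈-refl))
             (⊙-≋-cong (paritySign (n * m)) (subst-≋ (ℕₚ.+-comm m n) (y · x))))

  module ≋-Reasoning where
    infix  1 begin_
    infixr 2 _≋⟨_⟩_ _≈⟨_⟩_ _≈⟨_⟨_ _≡⟨_⟩_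
    infix  3 _∎

    begin_ : ∀ {n m} {x : Car n} {y : Car m} → x ≋ y → x ≋ y
    begin x≋y = x≋y

    _≋⟨_⟩_ : ∀ {n m k} (x : Car n) {y : Car m} {z : Car k} → x ≋ y → y ≋ z → x ≋ z
    x ≋⟨ x≋y ⟩ y≋z = ≋-trans x≋y y≋z

    _≈⟨_⟩_ : ∀ {n k} (x : Car n) {y : Car n} {z : Car k} → x ≈ y → y ≋ z → x ≋ z
    x ≈⟨ x≈y ⟩ y≋z = ≋-trans (≈⇒≋ x≈y) y≋z

    _≈⟨_⟨_ : ∀ {n k} (x : Car n) {y : Car n} {z : Car k} → y ≈ x → y ≋ z → x ≋ z
    x ≈⟨ y≈x ⟨ y≋z = ≋-trans (≈⇒≋ (≈-sym y≈x)) y≋z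

    _≡⟨_⟩_ : ∀ {n k} (x : Car n) {y : Car n} {z : Car k} → x ≡ y → y ≋ z → x ≋ z
    x ≡⟨ refl ⟩ y≋z = y≋z

    _∎ : ∀ {n} (x : Car n) → x ≋ x
    x ∎ = ≋-refl

-- The extension of f

module Extension (A : GradedCommAlg) (f : LinearV A) where

  open GradedCommAlg A
  open GradedCommAlgProperties A

  f₀ : ∀ {n} (M : Matroid n) → Connected M → Car n
  f₀ M c = fun f ([ M , Sign.+ ] , gen M Sign.+ c)

  f-orient : ∀ {n} (M : Matroid n) s c → fun f ([ M , s ] , gen M s c) ≈ (s ⊙ f₀ M c)
  f-orient M Sign.+ c = ≈-sym (⊙-identity _)
  f-orient M Sign.- c = ≈-trans
    (fun-cong f ([ M , Sign.- ] , gen M Sign.- c) ((- 1ℚ) ⊡ [ M , Sign.+ ] , (- 1ℚ) ⊡ gen M Sign.+ c) (orient M Sign.+))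
    (homog f (- 1ℚ) ([ M , Sign.+ ] , gen M Sign.+ c))

  f₀-iso : ∀ {a b} (ψ : Permutation a b) {N N'} cN cN' → IsIso′ ψ N N' → f₀ N' cN' ≋ (sgn′ ψ ⊙ f₀ N cN)
  f₀-iso ψ = square (Perm.↔⇒≡ ψ) ψ
    where
    square : ∀ {a b} → a ≡ b → (ψ : Permutation a b) → ∀ {N N'} cN cN' → IsIso′ ψ N N' →
             f₀ N' cN' ≋ (sgn′ ψ ⊙ f₀ N cN)
    square refl ψ {N} {N'} cN cN' ψ-iso = ≈⇒≋ (begin
      f₀ N' cN'                                  ≈⟨ ⊙-identity _ ⟨
      Sign.+ ⊙ f₀ N' cN'                         ≡⟨ cong (_⊙ f₀ N' cN') (sym s*t≡+) ⟩
      (s *ˢ t) ⊙ f₀ N' cN'                       ≈⟨ ⊙-assoc s t _ ⟨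
      s ⊙ t ⊙ f₀ N' cN'                          ≈⟨ ⊙-cong s (f-orient N' t cN') ⟨
      s ⊙ fun f ([ N' , t ] , gen N' t cN')       ≈⟨ ⊙-cong s (fun-cong f _ _ (∼-sym (iso N N' ψ ψ-iso Sign.+))) ⟩
      s ⊙ f₀ N cN ∎)
      where
      open ≈-Reasoning
      s = sgn′ ψ
      t = s *ˢ Sign.+
      s*t≡+ : s *ˢ t ≡ Sign.+
      s*t≡+ = trans (cong (s *ˢ_) (Signₚ.*-identityʳ s)) (Signₚ.s*s≡+ s)

  f₀-≅ : ∀ {a b} {M : Matroid a} {N : Matroid b} cM cN → M ≅ N → f₀ M cM ≋ f₀ N cN
  f₀-≅ {a} {M = M} {N} cM cN record { size = refl ; indep-cast = indep-cast } = ≋-sym (begin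
    f₀ N cN                       ≋⟨ f₀-iso (Perm.id {a}) cM cN id-iso ⟩
    sgn′ (Perm.id {a}) ⊙ f₀ M cM        ≈⟨ ≈-trans (≈-reflexive (cong (_⊙ f₀ M cM) (sgn′-id {a}))) (⊙-identity _) ⟩
    f₀ M cM ∎)
    where
    open ≋-Reasoning
    id-iso : IsIso′ (Perm.id {a}) M N
    id-iso S = trans (cong (indep N) (trans (image′-id S) (sym (cast-is-id refl S)))) (indep-cast S)

  opaque
    -- Φ′ k M is the intended value for matroids of size at most k; the fuel k makes the recursion
    -- on the complement of the component of zero structural.
    Φ′ : ℕ → ∀ {n} → Matroid n → Car n
    Φ′ _       {zero}  M = one
    Φ′ zero    {suc n} M = 0ᴬ
    Φ′ (suc k) {suc n} M =
      crossingSign C ⊙ subst Car (∣∣+∣∁∣ C) (f₀ (M ↾ C) (component₀-connected M) · Φ′ k (M ↾ ∁ C))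
      where
      C : Subset (suc n)
      C = component₀ M

    Φ : ∀ {n} → Matroid n → Car n
    Φ {n} = Φ′ n

    Φ-empty : ∀ {k} (N : Matroid k) → k ≡ 0 → Φ N ≋ one
    Φ-empty N refl = ≋-refl

    Φ′-fuel : ∀ k k' {n} (M : Matroid n) → n ≤ k → n ≤ k' → Φ′ k M ≡ Φ′ k' M
    Φ′-fuel k       k'       {zero}  M _         _          = refl
    Φ′-fuel (suc k) (suc k') {suc n} M (s≤s n≤k) (s≤s n≤k') =
      cong (λ x → crossingSign C ⊙ subst Car (∣∣+∣∁∣ C) (f₀ (M ↾ C) (component₀-connected M) · x))
           (Φ′-fuel k k' (M ↾ ∁ C) (ℕₚ.≤-trans ∣∁C∣≤n n≤k) (ℕₚ.≤-trans ∣∁C∣≤n n≤k'))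
      where
      C : Subset (suc n)
      C = component₀ M
      ∣∁C∣≤n : ∣ ∁ C ∣ ≤ n
      ∣∁C∣≤n = s≤s⁻¹ (∣∁component₀∣< M)

    Φ-unfold : ∀ {n} (M : Matroid (suc n)) → let C = component₀ M in
               Φ M ≋ crossingSign C ⊙ (f₀ (M ↾ C) (component₀-connected M) · Φ (M ↾ ∁ C))
    Φ-unfold {n} M = begin
      Φ M
        ≡⟨ cong (λ x → crossingSign C ⊙ subst Car (∣∣+∣∁∣ C) (f₀ (M ↾ C) (component₀-connected M) · x))
                (Φ′-fuel n _ (M ↾ ∁ C) (s≤s⁻¹ (∣∁component₀∣< M)) ℕₚ.≤-refl) ⟩
      crossingSign C ⊙ subst Car (∣∣+∣∁∣ C) (f₀ (M ↾ C) (component₀-connected M) · Φ (M ↾ ∁ C))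
        ≋⟨ ⊙-≋-cong (crossingSign C) (subst-≋ (∣∣+∣∁∣ C) _) ⟩
      crossingSign C ⊙ (f₀ (M ↾ C) (component₀-connected M) · Φ (M ↾ ∁ C)) ∎
      where
      open ≋-Reasoning
      C : Subset (suc n)
      C = component₀ M

  Φ-component : ∀ {n} (M : Matroid (suc n)) {C} → IsComponent₀ M C → (cC : Connected (M ↾ C)) →
                Φ M ≋ crossingSign C ⊙ (f₀ (M ↾ C) cC · Φ (M ↾ ∁ C))
  Φ-component {n} M isC = unfold (IsComponent₀-unique (component₀-isComponent₀ M) isC)
    where
    unfold : ∀ {C} → component₀ M ≡ C → (cC : Connected (M ↾ C)) →
             Φ M ≋ crossingSign C ⊙ (f₀ (M ↾ C) cC · Φ (M ↾ ∁ C))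
    unfold refl cC = ≋-trans (Φ-unfold M) (≈⇒≋ (⊙-cong (crossingSign C) (·-cong (fun-cong f _ _ ∼-refl) ≈-refl)))
      where C = component₀ M

  Φ-≗ : ∀ {n} {M N : Matroid n} → (∀ A → indep M A ≡ indep N A) → Φ M ≈ Φ N
  Φ-≗ {n} = <-rec (λ n → ∀ {M N : Matroid n} → (∀ A → indep M A ≡ indep N A) → Φ M ≈ Φ N) step n
    where
    step : ∀ n → (∀ {k} → k < n → ∀ {M N : Matroid k} → (∀ A → indep M A ≡ indep N A) → Φ M ≈ Φ N) →
           ∀ {M N : Matroid n} → (∀ A → indep M A ≡ indep N A) → Φ M ≈ Φ N
    step zero    _   {M} {N} M≗N = ≋⇒≈ (≋-trans (Φ-empty M refl) (≋-sym (Φ-empty N refl)))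
    step (suc n) rec {M} {N} M≗N = ≋⇒≈ (begin
      Φ M                                            ≋⟨ Φ-component M (component₀-isComponent₀ M) cM ⟩
      crossingSign C ⊙ (f₀ (M ↾ C) cM · Φ (M ↾ ∁ C))   ≋⟨ ⊙-≋-cong (crossingSign C) (·-≋-cong on-C (≈⇒≋ on-∁C)) ⟩
      crossingSign C ⊙ (f₀ (N ↾ C) cN · Φ (N ↾ ∁ C))   ≋⟨ ≋-sym (Φ-component N isC cN) ⟩
      Φ N ∎)
      where
      open ≋-Reasoning
      C = component₀ M
      cM = component₀-connected M
      isC : IsComponent₀ N C
      isC = record
        { separator = Separator-≗ {M = M} {N} M≗N separator
        ; zero∈     = zero∈
        ; minimal   = λ sepS → minimal (Separator-≗ {M = N} {M} (λ A → sym (M≗N A)) sepS)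
        }
        where open IsComponent₀ (component₀-isComponent₀ M)
      cN = IsComponent₀-connected isC
      on-C : f₀ (M ↾ C) cM ≋ f₀ (N ↾ C) cN
      on-C = f₀-≅ cM cN (≗⇒≅ λ A → M≗N _)
      on-∁C : Φ (M ↾ ∁ C) ≈ Φ (N ↾ ∁ C)
      on-∁C = rec (∣∁component₀∣< M) λ A → M≗N _

  Φ-≅ : ∀ {a b} {M : Matroid a} {N : Matroid b} → M ≅ N → Φ M ≋ Φ N
  Φ-≅ {N = N} record { size = refl ; indep-cast = indep-cast } =
    ≈⇒≋ (Φ-≗ λ A → trans (sym (indep-cast A)) (cong (indep N) (cast-is-id refl A)))

  Φ-connected : ∀ {n} (M : Matroid n) (c : Connected M) → Φ M ≈ f₀ M c
  Φ-connected {zero}  M (() , _)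
  Φ-connected {suc n} M c = ≋⇒≈ (begin
    Φ M
      ≋⟨ Φ-component M isC⊤ c⊤ ⟩
    crossingSign E ⊙ (f₀ (M ↾ E) c⊤ · Φ (M ↾ ∁ E))
      ≡⟨ cong (_⊙ (f₀ (M ↾ E) c⊤ · Φ (M ↾ ∁ E))) (crossingSign-⊤ (suc n)) ⟩
    Sign.+ ⊙ (f₀ (M ↾ E) c⊤ · Φ (M ↾ ∁ E))
      ≈⟨ ⊙-identity _ ⟩
    f₀ (M ↾ E) c⊤ · Φ (M ↾ ∁ E)
      ≋⟨ ·-≋-cong (f₀-≅ c⊤ c (↾⊤ M)) (Φ-empty (M ↾ ∁ E) ∣∁⊤∣≡0) ⟩
    f₀ M c · one
      ≋⟨ ·-identityʳ≋ (f₀ M c) ⟩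
    f₀ M c ∎)
    where
    open ≋-Reasoning
    E = ⊤ {suc n}
    isC⊤ : IsComponent₀ M E
    isC⊤ = subst (IsComponent₀ M) (connected⇒component₀≡⊤ M c) (component₀-isComponent₀ M)
    c⊤ = IsComponent₀-connected isC⊤
    crossingSign-⊤ : ∀ k → crossingSign (⊤ {k}) ≡ Sign.+
    crossingSign-⊤ zero    = refl
    crossingSign-⊤ (suc k) = crossingSign-⊤ k
    ∣∁⊤∣≡0 : ∣ ∁ E ∣ ≡ 0
    ∣∁⊤∣≡0 = trans (cong ∣_∣ (∁⊤ {suc n})) (∣⊥∣≡0 (suc n))

  Splits : ∀ {n} → Matroid n → Subset n → Set
  Splits M S = Φ M ≋ crossingSign S ⊙ (Φ (M ↾ S) · Φ (M ↾ ∁ S))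

  Splits-∁ : ∀ {n} (M : Matroid n) {S} → Splits M (∁ S) → Splits M S
  Splits-∁ M {S} splits∁S = begin
    Φ M
      ≋⟨ splits∁S ⟩
    crossingSign (∁ S) ⊙ (Φ (M ↾ ∁ S) · Φ (M ↾ ∁ (∁ S)))
      ≋⟨ ⊙-≋-cong (crossingSign (∁ S)) (·-≋-cong ≋-refl (Φ-≅ (↾-cong M (∁-involutive S)))) ⟩
    crossingSign (∁ S) ⊙ (Φ (M ↾ ∁ S) · Φ (M ↾ S))
      ≋⟨ ⊙-≋-cong (crossingSign (∁ S)) (·-comm≋ (Φ (M ↾ ∁ S)) (Φ (M ↾ S))) ⟩
    crossingSign (∁ S) ⊙ paritySign (∣ ∁ S ∣ * ∣ S ∣) ⊙ (Φ (M ↾ S) · Φ (M ↾ ∁ S))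
      ≈⟨ ⊙-assoc (crossingSign (∁ S)) _ _ ⟩
    (crossingSign (∁ S) *ˢ paritySign (∣ ∁ S ∣ * ∣ S ∣)) ⊙ (Φ (M ↾ S) · Φ (M ↾ ∁ S))
      ≡⟨ cong (_⊙ (Φ (M ↾ S) · Φ (M ↾ ∁ S))) (crossingSign-∁ S) ⟩
    crossingSign S ⊙ (Φ (M ↾ S) · Φ (M ↾ ∁ S)) ∎
    where open ≋-Reasoning

  -- With C the component of zero and C ⊆ S, split M at C and then M ↾ ∁ C at S ∖ C, or M at S and then
  -- M ↾ S at C: both give f (M ↾ C) · Φ (M ↾ S ∖ C) · Φ (M ↾ ∁ S), with the signs of crossingSign-⊆.
  Splits-∋zero : ∀ {n} (M : Matroid (suc n)) {S} → zero ∈ S → Separator M S →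
                 (∀ {T} → Separator (M ↾ ∁ (component₀ M)) T → Splits (M ↾ ∁ (component₀ M)) T) → Splits M S
  Splits-∋zero M {true ∷ S′} here sepS splits-Q = begin
    Φ M
      ≋⟨ Φ-component M isC cC ⟩
    crossingSign C ⊙ (a · Φ Q)
      ≋⟨ ⊙-≋-cong (crossingSign C) (·-≋-cong (≋-refl {x = a}) (splits-Q (Separator-trace M (∁ C) sepS))) ⟩
    crossingSign C ⊙ (a · crossingSign SQ ⊙ (Φ (Q ↾ SQ) · Φ (Q ↾ ∁ SQ)))
      ≋⟨ ⊙-≋-cong (crossingSign C) (·-≋-cong (≋-refl {x = a}) (⊙-≋-cong (crossingSign SQ) (·-≋-cong Q↾SQ Q↾∁SQ))) ⟩
    crossingSign C ⊙ (a · crossingSign SQ ⊙ (Φ (M ↾ S∖C) · Φ (M ↾ ∁ S)))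
      ≈⟨ ⊙-cong (crossingSign C) (⊙-·ʳ (crossingSign SQ) a _) ⟩
    crossingSign C ⊙ crossingSign SQ ⊙ (a · (Φ (M ↾ S∖C) · Φ (M ↾ ∁ S)))
      ≈⟨ ⊙-assoc (crossingSign C) (crossingSign SQ) _ ⟩
    (crossingSign C *ˢ crossingSign SQ) ⊙ (a · (Φ (M ↾ S∖C) · Φ (M ↾ ∁ S)))
      ≡⟨ cong (_⊙ (a · (Φ (M ↾ S∖C) · Φ (M ↾ ∁ S)))) (crossingSign-⊆ C⊆S) ⟩
    (crossingSign S *ˢ crossingSign SP) ⊙ (a · (Φ (M ↾ S∖C) · Φ (M ↾ ∁ S)))
      ≋⟨ ⊙-≋-cong (crossingSign S *ˢ crossingSign SP) (≋-sym (·-assoc≋ a (Φ (M ↾ S∖C)) (Φ (M ↾ ∁ S)))) ⟩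
    (crossingSign S *ˢ crossingSign SP) ⊙ ((a · Φ (M ↾ S∖C)) · Φ (M ↾ ∁ S))
      ≈⟨ ⊙-assoc (crossingSign S) (crossingSign SP) _ ⟨
    crossingSign S ⊙ crossingSign SP ⊙ ((a · Φ (M ↾ S∖C)) · Φ (M ↾ ∁ S))
      ≈⟨ ⊙-cong (crossingSign S) (⊙-·ˡ (crossingSign SP) (a · Φ (M ↾ S∖C)) (Φ (M ↾ ∁ S))) ⟨
    crossingSign S ⊙ ((crossingSign SP ⊙ (a · Φ (M ↾ S∖C))) · Φ (M ↾ ∁ S))
      ≋⟨ ⊙-≋-cong (crossingSign S) (·-≋-cong (≋-sym ΦP) ≋-refl) ⟩
    crossingSign S ⊙ (Φ P · Φ (M ↾ ∁ S)) ∎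
    where
    open ≋-Reasoning
    S = true ∷ S′
    C = component₀ M
    isC = component₀-isComponent₀ M
    cC = component₀-connected M
    C⊆S = IsComponent₀.minimal isC sepS here
    a = f₀ (M ↾ C) cC
    Q = M ↾ ∁ C
    SQ = trace (∁ C) S
    S∖C = S ∩ ∁ C
    Q↾SQ : Φ (Q ↾ SQ) ≋ Φ (M ↾ S∖C)
    Q↾SQ = Φ-≅ (↾-↾-trace M (∁ C) S)
    Q↾∁SQ : Φ (Q ↾ ∁ SQ) ≋ Φ (M ↾ ∁ S)
    Q↾∁SQ = ≋-trans (Φ-≅ (↾-↾-∁trace M (∁ C) S)) (Φ-≅ (↾-cong M (p⊆q⇒p∩q≡p (p⊆q⇒∁p⊇∁q C⊆S))))
    P = M ↾ S
    SP = trace S C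
    isCP : IsComponent₀ P SP
    isCP = IsComponent₀-↾ isC sepS
    cP = IsComponent₀-connected isCP
    ΦP : Φ P ≋ crossingSign SP ⊙ (a · Φ (M ↾ S∖C))
    ΦP = ≋-trans (Φ-component P isCP cP) (⊙-≋-cong (crossingSign SP) (·-≋-cong
      (f₀-≅ cP cC (≅-trans (↾-↾-trace M S C) (↾-cong M (p⊆q⇒p∩q≡p C⊆S))))
      (≋-trans (Φ-≅ (↾-↾-∁trace M S C)) (Φ-≅ (↾-cong M (∩-comm (∁ C) S))))))

  Φ-separator : ∀ {n} (M : Matroid n) {S} → Separator M S → Splits M S
  Φ-separator {n} = <-rec (λ n → ∀ (M : Matroid n) {S} → Separator M S → Splits M S) step n
    where
    step : ∀ n → (∀ {k} → k < n → ∀ (M : Matroid k) {S} → Separator M S → Splits M S) →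
           ∀ (M : Matroid n) {S} → Separator M S → Splits M S
    step zero    _   M {[]} _ = begin
      Φ M                                  ≋⟨ Φ-empty M refl ⟩
      one                                  ≈⟨ ·-idˡ one ⟨
      one · one                            ≋⟨ ·-≋-cong (≋-sym (Φ-empty (M ↾ []) refl)) (≋-sym Φ∅) ⟩
      Φ (M ↾ []) · Φ (M ↾ ∁ [])            ≈⟨ ⊙-identity _ ⟨
      Sign.+ ⊙ (Φ (M ↾ []) · Φ (M ↾ ∁ [])) ∎
      where
      open ≋-Reasoning
      Φ∅ = Φ-empty (M ↾ ∁ []) refl
    step (suc n) rec M {S} sepS with zero ∈? S
    ... | yes 0∈S = Splits-∋zero M 0∈S sepS (rec (∣∁component₀∣< M) _)
    ... | no  0∉S = Splits-∁ M (Splits-∋zero M (x∉p⇒x∈∁p 0∉S) (Separator-∁ M sepS) (rec (∣∁component₀∣< M) _))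

  Φ-iso : ∀ {a b} (ψ : Permutation a b) {M M'} → IsIso′ ψ M M' → Φ M' ≋ sgn′ ψ ⊙ Φ M
  Φ-iso {a} = <-rec (λ a → ∀ {b} (ψ : Permutation a b) {M M'} → IsIso′ ψ M M' → Φ M' ≋ sgn′ ψ ⊙ Φ M) step a
    where
    step : ∀ a → (∀ {k} → k < a → ∀ {b} (ψ : Permutation k b) {M M'} → IsIso′ ψ M M' → Φ M' ≋ sgn′ ψ ⊙ Φ M) →
           ∀ {b} (ψ : Permutation a b) {M M'} → IsIso′ ψ M M' → Φ M' ≋ sgn′ ψ ⊙ Φ M
    step zero    _   ψ {M} {M'} ψ-iso = begin
      Φ M'           ≋⟨ Φ-empty M' (sym (Perm.↔⇒≡ ψ)) ⟩
      one            ≋⟨ ≋-sym (Φ-empty M refl) ⟩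
      Φ M            ≈⟨ ⊙-identity (Φ M) ⟨
      Sign.+ ⊙ Φ M   ∎
      where open ≋-Reasoning
    step (suc n) rec ψ {M} {M'} ψ-iso = begin
      Φ M'
        ≋⟨ Φ-separator M' (Separator-image′ ψ {M} {M'} ψ-iso (IsComponent₀.separator isC)) ⟩
      crossingSign ψC ⊙ (Φ (M' ↾ ψC) · Φ (M' ↾ ∁ ψC))
        ≋⟨ ⊙-≋-cong (crossingSign ψC) (·-≋-cong on-C on-∁C) ⟩
      crossingSign ψC ⊙ ((s₁ ⊙ f₀ (M ↾ C) cC) · (s₂ ⊙ Φ (M ↾ ∁ C)))
        ≈⟨ ⊙-cong (crossingSign ψC) (≈-trans (⊙-·ˡ s₁ _ _) (⊙-cong s₁ (⊙-·ʳ s₂ _ _))) ⟩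
      crossingSign ψC ⊙ s₁ ⊙ s₂ ⊙ (f₀ (M ↾ C) cC · Φ (M ↾ ∁ C))
        ≈⟨ ≈-trans (⊙-cong (crossingSign ψC) (⊙-assoc s₁ s₂ _)) (⊙-assoc (crossingSign ψC) (s₁ *ˢ s₂) _) ⟩
      (crossingSign ψC *ˢ (s₁ *ˢ s₂)) ⊙ (f₀ (M ↾ C) cC · Φ (M ↾ ∁ C))
        ≡⟨ cong (_⊙ (f₀ (M ↾ C) cC · Φ (M ↾ ∁ C)))
                (trans (Signₚ.*-comm (crossingSign ψC) _) (sym (sgn′-split ψ C))) ⟩
      (sgn′ ψ *ˢ crossingSign C) ⊙ (f₀ (M ↾ C) cC · Φ (M ↾ ∁ C))
        ≈⟨ ⊙-assoc (sgn′ ψ) (crossingSign C) _ ⟨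
      sgn′ ψ ⊙ crossingSign C ⊙ (f₀ (M ↾ C) cC · Φ (M ↾ ∁ C))
        ≋⟨ ⊙-≋-cong (sgn′ ψ) (≋-sym (Φ-component M isC cC)) ⟩
      sgn′ ψ ⊙ Φ M ∎
      where
      open ≋-Reasoning
      C = component₀ M
      isC = component₀-isComponent₀ M
      cC = component₀-connected M
      ψC = image′ ψ C
      s₁ = sgn′ (restrictᵖ ψ C)
      s₂ = sgn′ (restrictᵖ ψ (∁ C))
      iso-C : IsIso′ (restrictᵖ ψ C) (M ↾ C) (M' ↾ ψC)
      iso-C = restrictᵖ-iso ψ C {M} {M'} ψ-iso
      cψC : Connected (M' ↾ ψC)
      cψC = Connected-iso (restrictᵖ ψ C) {M ↾ C} {M' ↾ ψC} iso-C cC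
      on-C : Φ (M' ↾ ψC) ≋ s₁ ⊙ f₀ (M ↾ C) cC
      on-C = ≋-trans (≈⇒≋ (Φ-connected (M' ↾ ψC) cψC)) (f₀-iso (restrictᵖ ψ C) cC cψC iso-C)
      on-∁C : Φ (M' ↾ ∁ ψC) ≋ s₂ ⊙ Φ (M ↾ ∁ C)
      on-∁C = ≋-trans (Φ-≅ (↾-cong M' (sym (image′-∁ ψ C))))
        (rec (∣∁component₀∣< M) (restrictᵖ ψ (∁ C)) (restrictᵖ-iso ψ (∁ C) {M} {M'} ψ-iso))

  Φ-directSum : ∀ {n m} (M : Matroid n) (Q : Matroid m) (R : Matroid (n + m)) →
                IsDirectSum M Q R → Φ R ≈ (Φ M · Φ Q)
  Φ-directSum {n} {m} M Q R R≡M⊕Q = ≋⇒≈ (begin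
    Φ R
      ≋⟨ Φ-separator R (Separator-leftPart M Q R R≡M⊕Q) ⟩
    crossingSign L ⊙ (Φ (R ↾ L) · Φ (R ↾ ∁ L))
      ≡⟨ cong (_⊙ (Φ (R ↾ L) · Φ (R ↾ ∁ L))) (crossingSign-leftPart n) ⟩
    Sign.+ ⊙ (Φ (R ↾ L) · Φ (R ↾ ∁ L))
      ≈⟨ ⊙-identity _ ⟩
    Φ (R ↾ L) · Φ (R ↾ ∁ L)
      ≋⟨ ·-≋-cong (Φ-≅ (↾leftPart M Q R R≡M⊕Q)) (Φ-≅ (↾∁leftPart M Q R R≡M⊕Q)) ⟩
    Φ M · Φ Q ∎)
    where
    open ≋-Reasoning
    L = leftPart n m

  F : ∀ {n} → Term n → Car n
  F [ M , s ] = s ⊙ Φ M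
  F 𝟘         = 0ᴬ
  F (x ⊞ y)   = F x +ᴬ F y
  F (q ⊡ x)   = q *ᴬ F x

  F-resp : ∀ {n} {x y : Term n} → x ∼ y → F x ≈ F y
  F-resp ∼-refl                 = ≈-refl
  F-resp (∼-sym x∼y)            = ≈-sym (F-resp x∼y)
  F-resp (∼-trans x∼y y∼z)      = ≈-trans (F-resp x∼y) (F-resp y∼z)
  F-resp {n} (⊞-cong x∼x' y∼y') = Modₙ.+ᴹ-cong n (F-resp x∼x') (F-resp y∼y')
  F-resp {n} (⊡-cong x∼x')      = Modₙ.*ₗ-cong n refl (F-resp x∼x')
  F-resp {n} (⊞-assoc x y z)    = Modₙ.+ᴹ-assoc n (F x) (F y) (F z)
  F-resp {n} (⊞-comm x y)       = Modₙ.+ᴹ-comm n (F x) (F y)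
  F-resp {n} (⊞-idˡ x)          = Modₙ.+ᴹ-identityˡ n (F x)
  F-resp {n} (⊞-inv x)          = ≈-trans (Modₙ.+ᴹ-cong n (≈-sym (Modₙ.*ₗ-identityˡ n (F x))) ≈-refl)
                                   (≈-trans (≈-sym (Modₙ.*ₗ-distribʳ n (F x) 1ℚ (- 1ℚ))) (Modₙ.*ₗ-zeroˡ n (F x)))
  F-resp {n} (⊡-distˡ q x y)    = Modₙ.*ₗ-distribˡ n q (F x) (F y)
  F-resp {n} (⊡-distʳ p q x)    = Modₙ.*ₗ-distribʳ n (F x) p q
  F-resp {n} (⊡-assoc p q x)    = Modₙ.*ₗ-assoc n p q (F x)
  F-resp {n} (⊡-id x)           = Modₙ.*ₗ-identityˡ n (F x)
  F-resp {n} (orient M s)       =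
    ≈-trans (Modₙ.*ₗ-cong n (signℚ-opposite s) ≈-refl) (Modₙ.*ₗ-assoc n (- 1ℚ) (signℚ s) (Φ M))
  F-resp {n} (iso M M' ψ ψ-iso s) = ≈-sym (begin
    (sgn′ ψ *ˢ s) ⊙ Φ M'           ≈⟨ ⊙-cong (sgn′ ψ *ˢ s) (≋⇒≈ (Φ-iso ψ ψ-iso)) ⟩
    (sgn′ ψ *ˢ s) ⊙ sgn′ ψ ⊙ Φ M   ≈⟨ ⊙-assoc (sgn′ ψ *ˢ s) (sgn′ ψ) (Φ M) ⟩
    ((sgn′ ψ *ˢ s) *ˢ sgn′ ψ) ⊙ Φ M ≡⟨ cong (_⊙ Φ M) (tt⁻¹ (sgn′ ψ) s) ⟩
    s ⊙ Φ M ∎)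
    where
    open ≈-Reasoning
    tt⁻¹ : ∀ t s → (t *ˢ s) *ˢ t ≡ s
    tt⁻¹ t s = trans (Signₚ.*-comm (t *ˢ s) t) (trans (sym (Signₚ.*-assoc t t s)) (cong (_*ˢ s) (Signₚ.s*s≡+ t)))

  F≈f : ∀ {n} {x : Term n} (x∈V : InV x) → F x ≈ fun f (x , x∈V)
  F≈f (gen M s c) = ≈-trans (⊙-cong s (Φ-connected M c)) (≈-sym (f-orient M s c))
  F≈f {n} 𝟘 = ≈-sym (begin
    fun f (𝟘 , 𝟘)               ≈⟨ fun-cong f (𝟘 , 𝟘) (0ℚ ⊡ 𝟘 , 0ℚ ⊡ 𝟘) 𝟘∼0⊡𝟘 ⟩
    fun f (0ℚ ⊡ 𝟘 , 0ℚ ⊡ 𝟘)      ≈⟨ homog f 0ℚ (𝟘 , 𝟘) ⟩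
    0ℚ *ᴬ fun f (𝟘 , 𝟘)          ≈⟨ Modₙ.*ₗ-zeroˡ n _ ⟩
    0ᴬ ∎)
    where
    open ≈-Reasoning
    𝟘∼0⊡𝟘 : 𝟘 ∼ 0ℚ ⊡ 𝟘
    𝟘∼0⊡𝟘 = ∼-sym (∼-trans (⊡-distʳ 1ℚ (- 1ℚ) 𝟘) (∼-trans (⊞-cong (⊡-id 𝟘) ∼-refl) (⊞-inv 𝟘)))
  F≈f {n} (_⊞_ {x} {y} x∈V y∈V) =
    ≈-trans (Modₙ.+ᴹ-cong n (F≈f x∈V) (F≈f y∈V)) (≈-sym (additive f (x , x∈V) (y , y∈V)))
  F≈f {n} (_⊡_ q {x} x∈V) = ≈-trans (Modₙ.*ₗ-cong n refl (F≈f x∈V)) (≈-sym (homog f q (x , x∈V)))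

  F-isExtMorphism : IsExtMorphism A f F
  F-isExtMorphism = record
    { resp      = F-resp
    ; F-zero    = ≈-refl
    ; F-add     = λ _ _ → ≈-refl
    ; F-scal    = λ _ _ → ≈-refl
    ; F-unit    = λ E → ≈-trans (⊙-identity (Φ E)) (≋⇒≈ (Φ-empty E refl))
    ; F-mult    = λ M Q R R≡M⊕Q s t → begin
        (s *ˢ t) ⊙ Φ R                 ≈⟨ ⊙-cong (s *ˢ t) (Φ-directSum M Q R R≡M⊕Q) ⟩
        (s *ˢ t) ⊙ (Φ M · Φ Q)         ≈⟨ ⊙-assoc s t _ ⟨
        s ⊙ t ⊙ (Φ M · Φ Q)            ≈⟨ ⊙-cong s (⊙-·ʳ t (Φ M) (Φ Q)) ⟨
        s ⊙ (Φ M · (t ⊙ Φ Q))          ≈⟨ ⊙-·ˡ s (Φ M) (t ⊙ Φ Q) ⟨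
        (s ⊙ Φ M) · (t ⊙ Φ Q) ∎
    ; F-extends = λ v → F≈f (proj₂ v)
    }
    where open ≈-Reasoning

  module _ {G : ∀ {n} → Term n → Car n} (isG : IsExtMorphism A f G) where
    open IsExtMorphism isG

    G-orient : ∀ {n} (M : Matroid n) s → G [ M , s ] ≈ (s ⊙ G [ M , Sign.+ ])
    G-orient M Sign.+ = ≈-sym (⊙-identity _)
    G-orient M Sign.- = ≈-trans (resp (orient M Sign.+)) (F-scal (- 1ℚ) [ M , Sign.+ ])

    G-iso : ∀ {a b} → a ≡ b → (σ : Permutation a b) → ∀ {M P} → IsIso′ σ M P → ∀ s →
            G [ M , s ] ≋ G [ P , sgn′ σ *ˢ s ]
    G-iso refl σ {M} {P} σ-iso s = ≈⇒≋ (resp (iso M P σ σ-iso s))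

    G≈Φ : ∀ {n} (M : Matroid n) → G [ M , Sign.+ ] ≈ Φ M
    G≈Φ {n} = <-rec (λ n → ∀ (M : Matroid n) → G [ M , Sign.+ ] ≈ Φ M) step n
      where
      step : ∀ n → (∀ {k} → k < n → ∀ (M : Matroid k) → G [ M , Sign.+ ] ≈ Φ M) →
             ∀ (M : Matroid n) → G [ M , Sign.+ ] ≈ Φ M
      step zero    _   M = ≋⇒≈ (≋-trans (≈⇒≋ (F-unit M)) (≋-sym (Φ-empty M refl)))
      step (suc n) rec M = ≋⇒≈ (begin
        G [ M , Sign.+ ]
          ≋⟨ G-iso (sym (∣∣+∣∁∣ C)) σ (permuteᴹ-iso σ M) Sign.+ ⟩
        G [ R , sgn′ σ *ˢ Sign.+ ]
          ≈⟨ G-orient R _ ⟩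
        (sgn′ σ *ˢ Sign.+) ⊙ G [ R , Sign.+ ]
          ≡⟨ cong (_⊙ G [ R , Sign.+ ]) (trans (Signₚ.*-identityʳ (sgn′ σ)) (sgn′-shuffle C)) ⟩
        crossingSign C ⊙ G [ R , Sign.+ ]
          ≈⟨ ⊙-cong (crossingSign C) (F-mult (M ↾ C) (M ↾ ∁ C) R R≡M↾C⊕M↾∁C Sign.+ Sign.+) ⟩
        crossingSign C ⊙ (G [ M ↾ C , Sign.+ ] · G [ M ↾ ∁ C , Sign.+ ])
          ≈⟨ ⊙-cong (crossingSign C) (·-cong (F-extends ([ M ↾ C , Sign.+ ] , gen _ _ cC))
                                              (rec (∣∁component₀∣< M) (M ↾ ∁ C))) ⟩
        crossingSign C ⊙ (f₀ (M ↾ C) cC · Φ (M ↾ ∁ C))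
          ≋⟨ ≋-sym (Φ-component M isC cC) ⟩
        Φ M ∎)
        where
        open ≋-Reasoning
        C = component₀ M
        isC = component₀-isComponent₀ M
        cC = component₀-connected M
        σ = shuffle C
        R = permuteᴹ σ M
        R≡M↾C⊕M↾∁C = shuffle-directSum C {M} (IsComponent₀.separator isC)

    G≈F : ∀ {n} (x : Term n) → G x ≈ F x
    G≈F [ M , s ] = ≈-trans (G-orient M s) (⊙-cong s (G≈Φ M))
    G≈F 𝟘         = F-zero
    G≈F {n} (x ⊞ y) = ≈-trans (F-add x y) (Modₙ.+ᴹ-cong n (G≈F x) (G≈F y))
    G≈F {n} (q ⊡ x) = ≈-trans (F-scal q x) (Modₙ.*ₗ-cong n refl (G≈F x))

theorem5p17 : (A : GradedCommAlg) (f : LinearV A) →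
    Σ (∀ {n} → Term n → GradedCommAlg.Car A n) (IsExtMorphism A f)
    × (∀ (F G : ∀ {n} → Term n → GradedCommAlg.Car A n) →
         IsExtMorphism A f F → IsExtMorphism A f G →
         ∀ {n} (x : Term n) → GradedCommAlg._≈_ A (F x) (G x))
theorem5p17 A f = (F , F-isExtMorphism) , λ G H isG isH x → ≈-trans (G≈F isG x) (≈-sym (G≈F isH x))
  where
  open GradedCommAlgProperties A
  open Extension A f
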